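{- Let $m\ge 1$, $n=2m$, $q=2^m$, let $\omega$ be a primitive element of $\mathbb{F}_{q^2}$ and $u=\omega^{(q-1)(2^{n-1}-1)}$, so that $u$ generates $\mu_{q+1}$ and $\mathbb{F}_{q^2}^*$ is the disjoint union of the cosets $u^i\mathbb{F}_q^*$, $i\in\mathbb{Z}_{q+1}$. Let $r_0,\dots,r_q$ be non-negative integers and $a_0,\dots,a_q\in\mathbb{F}_{q^2}$. Put $R_0=\{i\in\mathbb{Z}_{q+1}: r_i\equiv 0 \pmod{q-1}\}$ and $R_1=\{i\in\mathbb{Z}_{q+1}: r_i\equiv 2^{t_i}\pmod{q-1}\text{ for some integer } t_i\}$ (for $i\in R_1$ such a $t_i$ is fixed), and assume $\#R_0+\#R_1=q+1$. Define $f:\mathbb{F}_{q^2}\to\mathbb{F}_2$ by $f(0)=0$ and $f(x)={\rm Tr}_1^n(a_ix^{r_i})$ if $x\in u^i\mathbb{F}_q^*$, $i\in\mathbb{Z}_{q+1}$. For $i\in\mathbb{Z}_{q+1}$ let $\alpha_i=a_iu^{ir_i}+a_i^qu^{ -ir_i}\in\mathbb{F}_q$, let $M_0=\sum_{i\in R_0}(-1)^{{\rm Tr}_1^m(\alpha_i)}$, and for $i\in R_1$ and $b\in\mathbb{F}_{q^2}$ let $T_i(b)=1$ if $bu^i+b^qu^{ -i}=\alpha_i^{2^{ -t_i}}$ and $T_i(b)=0$ otherwise. Then for every $b\in\mathbb{F}_{q^2}$: $$\widehat{f}(b)=\begin{cases} q\big(M_0+\sum_{i\in R_1}T_i(b)\big)-(M_0+\#R_1-1),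 & b=0,\\ q\big((-1)^{{\rm Tr}_1^m(\alpha_t)}+\sum_{i\in R_1}T_i(b)\big)-(M_0+\#R_1-1), & b^{q-1}=u^{2t},\ t\in R_0,\\ q\sum_{i\in R_1}T_i(b)-(M_0+\#R_1-1), & b^{q-1}=u^{2t},\ t\in R_1.\end{cases}$$
   Context: ${\rm Tr}_1^k(x)=\sum_{j=0}^{k-1}x^{2^j}$ denotes the absolute trace of $\mathbb{F}_{2^k}$; $\mu_e=\{x: x^e=1\}$. For a Boolean function $f:\mathbb{F}_{2^n}\to\mathbb{F}_2$, the Walsh transform is $\widehat{f}(b)=\sum_{x\in\mathbb{F}_{2^n}}(-1)^{f(x)+{\rm Tr}_1^n(bx)}$. For $y\in\mathbb{F}_q$, $y^{2^{ -t}}$ denotes the unique $z\in\mathbb{F}_q$ with $z^{2^t}=y$. -}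

module Defs where

open import Level using (0ℓ)
open import Data.Nat as ℕ using (ℕ; zero; suc; _∸_; _<_)
open import Data.Integer as ℤ using (ℤ; +_)
open import Data.Fin using (Fin; toℕ)
open import Data.Fin.Subset using (Subset; _∈_)
open import Data.Fin.Subset.Properties using (_∈?_)
open import Data.List using (List; map; foldr)
open import Data.List.Base using (allFin)
open import Data.Bool using (Bool; true; false; if_then_else_)
open import Relation.Nullary using (Dec; yes; no; ¬_)
open import Relation.Nullary.Decidable using (⌊_⌋)
open import Relation.Binary.PropositionalEquality using (_≡_; _≢_; refl; sym; trans; cong)
open import Function.Bundles using (_↔_; Inverse)
open import Algebra.Structures using (IsCommutativeRing)
import Data.Fin.Properties as FinP

-- A finite field with exactly 2^n elements (i.e. a model of F_{2^n}),
-- with propositional equality, a total inverse map (0⁻¹ is junk) and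
-- characteristic 2.
record GF2 (n : ℕ) : Set₁ where
  infixl 6 _+_
  infixl 7 _*_
  infix 4 _≟_
  field
    Carrier : Set
    _+_ _*_ : Carrier → Carrier → Carrier
    -_ : Carrier → Carrier
    0# 1# : Carrier
    _⁻¹ : Carrier → Carrier
    isCommutativeRing : IsCommutativeRing _≡_ _+_ _*_ -_ 0# 1#
    0≢1 : 0# ≢ 1#
    inverse : ∀ x → x ≢ 0# → x * (x ⁻¹) ≡ 1#
    char2 : 1# + 1# ≡ 0#
    enum : Fin (2 ℕ.^ n) ↔ Carrier

  _≟_ : (x y : Carrier) → Dec (x ≡ y)
  x ≟ y with Inverse.from enum x FinP.≟ Inverse.from enum y
  ... | yes p = yes (trans (sym (Inverse.strictlyInverseˡ enum x))
                     (trans (cong (Inverse.to enum) p) (Inverse.strictlyInverseˡ enum y)))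
  ... | no ¬p = no (λ e → ¬p (cong (Inverse.from enum) e))

  _^_ : Carrier → ℕ → Carrier
  x ^ zero = 1#
  x ^ suc k = x * (x ^ k)

  -- Σ_{j<k} y^{2^j}; Tr_1^n(y) = trace n y, Tr_1^m(y) = trace m y
  trace : ℕ → Carrier → Carrier
  trace zero y = 0#
  trace (suc k) y = trace k y + (y ^ (2 ℕ.^ k))

  -- (-1)^c for c ∈ F_2 ⊆ the field (c = 0# ↦ 1, otherwise ↦ -1)
  sign : Carrier → ℤ
  sign c = if ⌊ c ≟ 0# ⌋ then + 1 else ℤ.- (+ 1)

  sumF : (Carrier → ℤ) → ℤ
  sumF g = foldr ℤ._+_ (+ 0) (map (λ i → g (Inverse.to enum i)) (allFin (2 ℕ.^ n)))

  walsh : (Carrier → Carrier) → Carrier → ℤ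
  walsh f b = sumF (λ x → sign (f x + trace n (b * x)))

  IsPrimitive : Carrier → Set
  IsPrimitive w = (w ^ (2 ℕ.^ n ∸ 1) ≡ 1#)
                × (∀ k → 0 < k → k < 2 ℕ.^ n ∸ 1 → w ^ k ≢ 1#)
    where open import Data.Product using (_×_)

sumFin : (N : ℕ) → (Fin N → ℤ) → ℤ
sumFin N g = foldr ℤ._+_ (+ 0) (map g (allFin N))

sumSub : {N : ℕ} → Subset N → (Fin N → ℤ) → ℤ
sumSub {N} R g = sumFin N (λ i → if ⌊ i ∈? R ⌋ then g i else + 0)

-- Enumerate F_{q²}^* as powers of ω.  Splitting the exponent by its residue
-- modulo q + 1 decomposes F_{q²}^* into the cosets u^i F_q^*, and on u^i F_q^*
-- the Walsh summand is (-1)^(Tr_m(α_i y^(r_i)) + Tr_m(β_i y)) with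
-- β_i = b u^i + b^q u^(-i) ∈ F_q.  For i ∈ R₀ we have y^(r_i) = 1, and for
-- i ∈ R₁ Frobenius invariance of the trace gives Tr_m(α_i y^(r_i)) = Tr_m(α_i^(2^-t_i) y);
-- in both cases the coset contributes a character sum
-- Σ_{y ∈ F_q^*} (-1)^Tr_m(γ y) = q [γ = 0] - 1.  Finally all β_i vanish when
-- b = 0, and when b^(q-1) = u^(2s) exactly β_s does.

module Submission where

open import Defs
open import Level using (0ℓ)
open import Algebra.Bundles using (CommutativeRing; CommutativeMonoid)
import Algebra.Properties.Semiring.Sum
open import Algebra.Structures using (IsCommutativeRing)
open import Data.Nat as ℕ using (ℕ; zero; suc; _∸_; _<_; _≤_; z≤n; s≤s; z<s; NonZero)
import Data.Nat.Properties as ℕP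
open import Data.Nat.Divisibility as ℕD using (divides)
import Data.Integer.Divisibility as ℤD
open import Data.Nat.Tactic.RingSolver using (solve-∀)
open import Data.Integer.Tactic.RingSolver using () renaming (solve-∀ to ℤ-solve-∀)
open import Data.Integer as ℤ using (ℤ)
import Data.Integer.Properties as ℤP
open import Data.Fin as Fin using (Fin; toℕ; zero; suc; _↑ˡ_; _↑ʳ_; combine)
import Data.Fin.Properties as FinP
open import Data.Fin.Permutation using (Permutation)
open import Data.Fin.Subset using (Subset; _∈_; ∣_∣; ⊤)
open import Data.Fin.Subset.Properties using (_∈?_; ∣⊤∣≡n; p⊆q⇒∣p∣≤∣q∣)
open import Data.List using (foldr; tabulate)
open import Data.List.Properties using (map-tabulate)
open import Data.Vec using (_∷_; []; here; there)
open import Data.Bool using (true; false; if_then_else_)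
open import Data.Product using (_×_; _,_; ∃; proj₁; proj₂)
open import Data.Sum using (_⊎_; inj₁; inj₂; [_,_]′) renaming (map to ⊎-map)
open import Data.Empty using (⊥; ⊥-elim)
open import Relation.Nullary using (yes; no; ¬_)
open import Relation.Nullary.Decidable using (⌊_⌋)
open import Relation.Binary.PropositionalEquality
  using (_≡_; _≢_; refl; sym; trans; cong; cong₂; subst; module ≡-Reasoning)
open import Function using (_∘_; Inverse)
open import Function.Bundles using (mk↔ₛ′; _⇔_; Equivalence)

-- Identities about q = 2p, p ≥ 1.  Each is proved for p = suc x with the
-- ∸ already computed away, because the ring solver cannot see through ∸.
module ArithmeticOfq where

  q∸1*q+1≡q*q∸1 : ∀ p .{{_ : NonZero p}} → (2 ℕ.* p ∸ 1) ℕ.* (2 ℕ.* p ℕ.+ 1) ≡ 2 ℕ.* p ℕ.* (2 ℕ.* p) ∸ 1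
  q∸1*q+1≡q*q∸1 (suc x) = normal x
    where
    normal : ∀ x → (x ℕ.+ (suc x ℕ.+ 0)) ℕ.* ((suc x ℕ.+ (suc x ℕ.+ 0)) ℕ.+ 1)
                 ≡ (x ℕ.+ (suc x ℕ.+ 0)) ℕ.+ (x ℕ.+ (suc x ℕ.+ 0)) ℕ.* (suc x ℕ.+ (suc x ℕ.+ 0))
    normal = solve-∀

  q∸1*[pq∸1]≡1+[q+1]*e : ∀ p .{{_ : NonZero p}} → let q = 2 ℕ.* p in
    (q ∸ 1) ℕ.* (p ℕ.* q ∸ 1) ≡ 1 ℕ.+ (q ℕ.+ 1) ℕ.* (q ℕ.* (p ∸ 1))
  q∸1*[pq∸1]≡1+[q+1]*e (suc x) = normal x
    where
    normal : ∀ x → (x ℕ.+ (suc x ℕ.+ 0)) ℕ.* ((x ℕ.+ (suc x ℕ.+ 0)) ℕ.+ x ℕ.* (suc x ℕ.+ (suc x ℕ.+ 0)))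
                 ≡ 1 ℕ.+ ((suc x ℕ.+ (suc x ℕ.+ 0)) ℕ.+ 1) ℕ.* ((suc x ℕ.+ (suc x ℕ.+ 0)) ℕ.* x)
    normal = solve-∀

  p+[p∸1]≡2p∸1 : ∀ p .{{_ : NonZero p}} → p ℕ.+ (p ∸ 1) ≡ 2 ℕ.* p ∸ 1
  p+[p∸1]≡2p∸1 (suc x) = normal x
    where
    normal : ∀ x → suc x ℕ.+ x ≡ x ℕ.+ (suc x ℕ.+ 0)
    normal = solve-∀

  2p∸1≡1+2[p∸1] : ∀ p .{{_ : NonZero p}} → 2 ℕ.* p ∸ 1 ≡ suc (2 ℕ.* (p ∸ 1))
  2p∸1≡1+2[p∸1] (suc x) = ℕP.+-suc x (x ℕ.+ 0)

module CharacteristicTwo {k : ℕ} (F : GF2 k) where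
  open GF2 F public
  open IsCommutativeRing isCommutativeRing public
    using (+-assoc; +-comm; +-identityˡ; +-identityʳ; *-assoc; *-comm; *-identityˡ; *-identityʳ;
           distribˡ; distribʳ; zeroˡ; zeroʳ)
  open ≡-Reasoning

  commutativeRing : CommutativeRing 0ℓ 0ℓ
  commutativeRing = record { isCommutativeRing = isCommutativeRing }

  open import Algebra.Properties.Group (CommutativeRing.+-group commutativeRing) public
    using () renaming (∙-cancelˡ to +-cancelˡ)

  x+x≡0 : ∀ x → x + x ≡ 0#
  x+x≡0 x = begin
    x + x             ≡⟨ cong₂ _+_ (*-identityʳ x) (*-identityʳ x) ⟨
    x * 1# + x * 1#   ≡⟨ distribˡ x 1# 1# ⟨
    x * (1# + 1#)     ≡⟨ cong (x *_) char2 ⟩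
    x * 0#            ≡⟨ zeroʳ x ⟩
    0#                ∎

  x+y≡0⇒x≡y : ∀ {x y} → x + y ≡ 0# → x ≡ y
  x+y≡0⇒x≡y {x} {y} e = +-cancelˡ y x y (trans (+-comm y x) (trans e (sym (x+x≡0 y))))

  x≡y⇒x+y≡0 : ∀ {x y} → x ≡ y → x + y ≡ 0#
  x≡y⇒x+y≡0 {x} refl = x+x≡0 x

  ^-homo-* : ∀ x a b → x ^ (a ℕ.+ b) ≡ x ^ a * x ^ b
  ^-homo-* x zero    b = sym (*-identityˡ _)
  ^-homo-* x (suc a) b = trans (cong (x *_) (^-homo-* x a b)) (sym (*-assoc x _ _))

  ^-assocʳ : ∀ x a b → (x ^ a) ^ b ≡ x ^ (a ℕ.* b)
  ^-assocʳ x a zero    = cong (x ^_) (sym (ℕP.*-zeroʳ a))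
  ^-assocʳ x a (suc b) = begin
    x ^ a * (x ^ a) ^ b     ≡⟨ cong (x ^ a *_) (^-assocʳ x a b) ⟩
    x ^ a * x ^ (a ℕ.* b)   ≡⟨ ^-homo-* x a (a ℕ.* b) ⟨
    x ^ (a ℕ.+ a ℕ.* b)     ≡⟨ cong (x ^_) (ℕP.*-suc a b) ⟨
    x ^ (a ℕ.* suc b)       ∎

  ^-comm : ∀ x a b → (x ^ a) ^ b ≡ (x ^ b) ^ a
  ^-comm x a b = trans (^-assocʳ x a b) (trans (cong (x ^_) (ℕP.*-comm a b)) (sym (^-assocʳ x b a)))

  ^-distrib-* : ∀ x y a → (x * y) ^ a ≡ x ^ a * y ^ a
  ^-distrib-* x y zero    = sym (*-identityˡ 1#)
  ^-distrib-* x y (suc a) = begin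
    (x * y) * (x * y) ^ a         ≡⟨ cong ((x * y) *_) (^-distrib-* x y a) ⟩
    (x * y) * (x ^ a * y ^ a)     ≡⟨ *-assoc x y _ ⟩
    x * (y * (x ^ a * y ^ a))     ≡⟨ cong (x *_) (*-assoc y _ _) ⟨
    x * ((y * x ^ a) * y ^ a)     ≡⟨ cong (λ z → x * (z * y ^ a)) (*-comm y _) ⟩
    x * ((x ^ a * y) * y ^ a)     ≡⟨ cong (x *_) (*-assoc _ y _) ⟩
    x * (x ^ a * (y * y ^ a))     ≡⟨ *-assoc x _ _ ⟨
    (x * x ^ a) * (y * y ^ a)     ∎

  1^a≡1 : ∀ a → 1# ^ a ≡ 1#
  1^a≡1 zero    = refl
  1^a≡1 (suc a) = trans (*-identityˡ _) (1^a≡1 a)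

  0^[1+a]≡0 : ∀ a → 0# ^ suc a ≡ 0#
  0^[1+a]≡0 a = zeroˡ _

  x^1≡x : ∀ x → x ^ 1 ≡ x
  x^1≡x = *-identityʳ

  x^2≡x*x : ∀ x → x ^ 2 ≡ x * x
  x^2≡x*x x = cong (x *_) (*-identityʳ x)

  freshman : ∀ x y → (x + y) ^ 2 ≡ x ^ 2 + y ^ 2
  freshman x y = begin
    (x + y) ^ 2                          ≡⟨ x^2≡x*x (x + y) ⟩
    (x + y) * (x + y)                    ≡⟨ distribʳ (x + y) x y ⟩
    x * (x + y) + y * (x + y)            ≡⟨ cong₂ _+_ (distribˡ x x y) (distribˡ y x y) ⟩
    (x * x + x * y) + (y * x + y * y)    ≡⟨ cong (λ z → (x * x + x * y) + (z + y * y)) (*-comm y x) ⟩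
    (x * x + x * y) + (x * y + y * y)    ≡⟨ +-assoc (x * x) _ _ ⟩
    x * x + (x * y + (x * y + y * y))    ≡⟨ cong (x * x +_) (+-assoc _ _ _) ⟨
    x * x + ((x * y + x * y) + y * y)    ≡⟨ cong (λ z → x * x + (z + y * y)) (x+x≡0 _) ⟩
    x * x + (0# + y * y)                 ≡⟨ cong (x * x +_) (+-identityˡ _) ⟩
    x * x + y * y                        ≡⟨ cong₂ _+_ (x^2≡x*x x) (x^2≡x*x y) ⟨
    x ^ 2 + y ^ 2                        ∎

  frobenius-+ : ∀ j x y → (x + y) ^ (2 ℕ.^ j) ≡ x ^ (2 ℕ.^ j) + y ^ (2 ℕ.^ j)
  frobenius-+ zero    x y = trans (x^1≡x _) (sym (cong₂ _+_ (x^1≡x x) (x^1≡x y)))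
  frobenius-+ (suc j) x y = begin
    (x + y) ^ (2 ℕ.* 2 ℕ.^ j)                     ≡⟨ ^-assocʳ (x + y) 2 (2 ℕ.^ j) ⟨
    ((x + y) ^ 2) ^ (2 ℕ.^ j)                     ≡⟨ cong (_^ (2 ℕ.^ j)) (freshman x y) ⟩
    (x ^ 2 + y ^ 2) ^ (2 ℕ.^ j)                   ≡⟨ frobenius-+ j _ _ ⟩
    (x ^ 2) ^ (2 ℕ.^ j) + (y ^ 2) ^ (2 ℕ.^ j)     ≡⟨ cong₂ _+_ (^-assocʳ x 2 (2 ℕ.^ j)) (^-assocʳ y 2 (2 ℕ.^ j)) ⟩
    x ^ (2 ℕ.* 2 ℕ.^ j) + y ^ (2 ℕ.* 2 ℕ.^ j)     ∎

  1≢0 : 1# ≢ 0#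
  1≢0 e = 0≢1 (sym e)

  ⁻¹-inverseˡ : ∀ x → x ≢ 0# → x ⁻¹ * x ≡ 1#
  ⁻¹-inverseˡ x x≢0 = trans (*-comm _ x) (inverse x x≢0)

  *-cancelˡ : ∀ x {y z} → x ≢ 0# → x * y ≡ x * z → y ≡ z
  *-cancelˡ x {y} {z} x≢0 e = begin
    y                  ≡⟨ *-identityˡ y ⟨
    1# * y             ≡⟨ cong (_* y) (⁻¹-inverseˡ x x≢0) ⟨
    (x ⁻¹ * x) * y     ≡⟨ *-assoc _ x y ⟩
    x ⁻¹ * (x * y)     ≡⟨ cong (x ⁻¹ *_) e ⟩
    x ⁻¹ * (x * z)     ≡⟨ *-assoc _ x z ⟨
    (x ⁻¹ * x) * z     ≡⟨ cong (_* z) (⁻¹-inverseˡ x x≢0) ⟩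
    1# * z             ≡⟨ *-identityˡ z ⟩
    z                  ∎

  x*y≡0⇒x≡0⊎y≡0 : ∀ x y → x * y ≡ 0# → x ≡ 0# ⊎ y ≡ 0#
  x*y≡0⇒x≡0⊎y≡0 x y e with x ≟ 0#
  ... | yes x≡0 = inj₁ x≡0
  ... | no  x≢0 = inj₂ (*-cancelˡ x x≢0 (trans e (sym (zeroʳ x))))

  *-≢0 : ∀ {x y} → x ≢ 0# → y ≢ 0# → x * y ≢ 0#
  *-≢0 {x} {y} x≢0 y≢0 e with x*y≡0⇒x≡0⊎y≡0 x y e
  ... | inj₁ x≡0 = x≢0 x≡0
  ... | inj₂ y≡0 = y≢0 y≡0

  ^-≢0 : ∀ {x} a → x ≢ 0# → x ^ a ≢ 0#
  ^-≢0 zero    x≢0 = 1≢0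
  ^-≢0 (suc a) x≢0 = *-≢0 x≢0 (^-≢0 a x≢0)

  ⁻¹-unique : ∀ x y → x * y ≡ 1# → y ≡ x ⁻¹
  ⁻¹-unique x y e = *-cancelˡ x x≢0 (trans e (sym (inverse x x≢0)))
    where
    x≢0 : x ≢ 0#
    x≢0 x≡0 = 0≢1 (trans (sym (zeroˡ y)) (trans (cong (_* y) (sym x≡0)) e))

  x^2≡0⇒x≡0 : ∀ x → x ^ 2 ≡ 0# → x ≡ 0#
  x^2≡0⇒x≡0 x e with x ≟ 0#
  ... | yes x≡0 = x≡0
  ... | no  x≢0 = ⊥-elim (^-≢0 2 x≢0 e)

  square-injective : ∀ {x y} → x ^ 2 ≡ y ^ 2 → x ≡ y
  square-injective {x} {y} e = x+y≡0⇒x≡y (x^2≡0⇒x≡0 (x + y) (trans (freshman x y) (x≡y⇒x+y≡0 e)))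

  frobenius-injective : ∀ j {x y} → x ^ (2 ℕ.^ j) ≡ y ^ (2 ℕ.^ j) → x ≡ y
  frobenius-injective zero    {x} {y} e = trans (sym (x^1≡x x)) (trans e (x^1≡x y))
  frobenius-injective (suc j) {x} {y} e = square-injective (frobenius-injective j
    (trans (^-assocʳ x 2 (2 ℕ.^ j)) (trans e (sym (^-assocʳ y 2 (2 ℕ.^ j))))))

  ^-≡1 : ∀ {x} N → x ^ N ≡ 1# → ∀ {a} → N ℕD.∣ a → x ^ a ≡ 1#
  ^-≡1 {x} N x^N≡1 (divides d refl) = begin
    x ^ (d ℕ.* N)   ≡⟨ cong (x ^_) (ℕP.*-comm d N) ⟩
    x ^ (N ℕ.* d)   ≡⟨ ^-assocʳ x N d ⟨
    (x ^ N) ^ d     ≡⟨ cong (_^ d) x^N≡1 ⟩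
    1# ^ d          ≡⟨ 1^a≡1 d ⟩
    1#              ∎

  ^-≡-∸ : ∀ {x} N → x ^ N ≡ 1# → ∀ {a b} → b ≤ a → N ℕD.∣ a ∸ b → x ^ a ≡ x ^ b
  ^-≡-∸ {x} N x^N≡1 {a} {b} b≤a N∣a∸b = begin
    x ^ a                    ≡⟨ cong (x ^_) (ℕP.m+[n∸m]≡n b≤a) ⟨
    x ^ (b ℕ.+ (a ∸ b))      ≡⟨ ^-homo-* x b (a ∸ b) ⟩
    x ^ b * x ^ (a ∸ b)      ≡⟨ cong (x ^ b *_) (^-≡1 N x^N≡1 N∣a∸b) ⟩
    x ^ b * 1#               ≡⟨ *-identityʳ _ ⟩
    x ^ b                    ∎

  ^-≡-mod : ∀ {x} N → x ^ N ≡ 1# → ∀ a b → (ℤ.+ N) ℤD.∣ (ℤ.+ a) ℤ.- (ℤ.+ b) → x ^ a ≡ x ^ b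
  ^-≡-mod N x^N≡1 a b N∣a-b with ℕP.≤-total b a
  ... | inj₁ b≤a = ^-≡-∸ N x^N≡1 b≤a (subst (N ℕD.∣_) ∣a-b∣≡a∸b N∣a-b)
    where
    ∣a-b∣≡a∸b : ℤ.∣ (ℤ.+ a) ℤ.- (ℤ.+ b) ∣ ≡ a ∸ b
    ∣a-b∣≡a∸b = cong ℤ.∣_∣ (trans (ℤP.m-n≡m⊖n a b) (ℤP.⊖-≥ b≤a))
  ... | inj₂ a≤b = sym (^-≡-∸ N x^N≡1 a≤b (subst (N ℕD.∣_) ∣a-b∣≡b∸a N∣a-b))
    where
    ∣a-b∣≡b∸a : ℤ.∣ (ℤ.+ a) ℤ.- (ℤ.+ b) ∣ ≡ b ∸ a
    ∣a-b∣≡b∸a = trans (cong ℤ.∣_∣ (ℤP.m-n≡m⊖n a b))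
                  (trans (ℤP.∣m⊖n∣≡∣n⊖m∣ a b) (cong ℤ.∣_∣ (ℤP.⊖-≥ a≤b)))

  module _ {x} (N : ℕ) (x≢0 : x ≢ 0#) (order : ∀ a → x ^ a ≡ 1# → N ℕD.∣ a) where

    private
      ≤-^-injective : ∀ {a b} → a ≤ b → b < N → x ^ b ≡ x ^ a → b ≡ a
      ≤-^-injective {a} {b} a≤b b<N e = begin
        b                  ≡⟨ ℕP.m+[n∸m]≡n a≤b ⟨
        a ℕ.+ (b ∸ a)      ≡⟨ cong (a ℕ.+_) (small-multiple (b ∸ a) (ℕP.≤-<-trans (ℕP.m∸n≤m b a) b<N) (order (b ∸ a) x^[b∸a]≡1)) ⟩
        a ℕ.+ 0            ≡⟨ ℕP.+-identityʳ a ⟩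
        a                  ∎
        where
        x^[b∸a]≡1 : x ^ (b ∸ a) ≡ 1#
        x^[b∸a]≡1 = *-cancelˡ (x ^ a) (^-≢0 a x≢0) (begin
          x ^ a * x ^ (b ∸ a)   ≡⟨ ^-homo-* x a (b ∸ a) ⟨
          x ^ (a ℕ.+ (b ∸ a))   ≡⟨ cong (x ^_) (ℕP.m+[n∸m]≡n a≤b) ⟩
          x ^ b                 ≡⟨ e ⟩
          x ^ a                 ≡⟨ *-identityʳ _ ⟨
          x ^ a * 1#            ∎)
        small-multiple : ∀ d → d < N → N ℕD.∣ d → d ≡ 0
        small-multiple zero    _   _   = refl
        small-multiple (suc d) d<N N∣d = ⊥-elim (ℕD.>⇒∤ d<N N∣d)

    ^-injective : ∀ {a b} → a < N → b < N → x ^ a ≡ x ^ b → a ≡ b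
    ^-injective {a} {b} a<N b<N e with ℕP.≤-total a b
    ... | inj₁ a≤b = sym (≤-^-injective a≤b b<N (sym e))
    ... | inj₂ b≤a = ≤-^-injective b≤a a<N e

  trace-0 : ∀ j → trace j 0# ≡ 0#
  trace-0 zero    = refl
  trace-0 (suc j) = trans (cong₂ _+_ (trace-0 j) 0^2^j≡0) (+-identityˡ 0#)
    where
    0^2^j≡0 : 0# ^ (2 ℕ.^ j) ≡ 0#
    0^2^j≡0 = subst (λ e → 0# ^ e ≡ 0#) (ℕP.suc-pred (2 ℕ.^ j) {{ℕP.m^n≢0 2 j}}) (0^[1+a]≡0 (ℕ.pred (2 ℕ.^ j)))

  +-interchange : ∀ a b c d → (a + b) + (c + d) ≡ (a + c) + (b + d)
  +-interchange a b c d = begin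
    (a + b) + (c + d)   ≡⟨ +-assoc a b (c + d) ⟩
    a + (b + (c + d))   ≡⟨ cong (a +_) (+-assoc b c d) ⟨
    a + ((b + c) + d)   ≡⟨ cong (λ z → a + (z + d)) (+-comm b c) ⟩
    a + ((c + b) + d)   ≡⟨ cong (a +_) (+-assoc c b d) ⟩
    a + (c + (b + d))   ≡⟨ +-assoc a c (b + d) ⟨
    (a + c) + (b + d)   ∎

  trace-+ : ∀ j x y → trace j (x + y) ≡ trace j x + trace j y
  trace-+ zero    x y = sym (+-identityˡ 0#)
  trace-+ (suc j) x y = trans (cong₂ _+_ (trace-+ j x y) (frobenius-+ j x y)) (+-interchange _ _ _ _)

  trace-+-split : ∀ a b w → trace (a ℕ.+ b) w ≡ trace a w + trace b (w ^ (2 ℕ.^ a))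
  trace-+-split a zero    w = trans (cong (λ z → trace z w) (ℕP.+-identityʳ a)) (sym (+-identityʳ _))
  trace-+-split a (suc b) w = begin
    trace (a ℕ.+ suc b) w                                               ≡⟨ cong (λ z → trace z w) (ℕP.+-suc a b) ⟩
    trace (a ℕ.+ b) w + w ^ (2 ℕ.^ (a ℕ.+ b))                           ≡⟨ cong₂ _+_ (trace-+-split a b w) w^2^[a+b] ⟩
    (trace a w + trace b (w ^ (2 ℕ.^ a))) + (w ^ (2 ℕ.^ a)) ^ (2 ℕ.^ b) ≡⟨ +-assoc _ _ _ ⟩
    trace a w + trace (suc b) (w ^ (2 ℕ.^ a))                           ∎
    where
    w^2^[a+b] : w ^ (2 ℕ.^ (a ℕ.+ b)) ≡ (w ^ (2 ℕ.^ a)) ^ (2 ℕ.^ b)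
    w^2^[a+b] = trans (cong (w ^_) (ℕP.^-distribˡ-+-* 2 a b)) (sym (^-assocʳ w (2 ℕ.^ a) (2 ℕ.^ b)))

  trace-frobenius : ∀ j w → trace j w ^ 2 ≡ trace j (w ^ 2)
  trace-frobenius zero    w = trans (x^2≡x*x 0#) (zeroˡ 0#)
  trace-frobenius (suc j) w = trans (freshman _ _) (cong₂ _+_ (trace-frobenius j w) (^-comm w (2 ℕ.^ j) 2))

  IsBit : Carrier → Set
  IsBit x = x ≡ 0# ⊎ x ≡ 1#

  x^2≡x⇒IsBit : ∀ {x} → x ^ 2 ≡ x → IsBit x
  x^2≡x⇒IsBit {x} e with x ≟ 0#
  ... | yes x≡0 = inj₁ x≡0
  ... | no  x≢0 = inj₂ (*-cancelˡ x x≢0 (trans (sym (x^2≡x*x x)) (trans e (sym (*-identityʳ x)))))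

  sign-0 : sign 0# ≡ ℤ.+ 1
  sign-0 with 0# ≟ 0#
  ... | yes _   = refl
  ... | no  0≢0 = ⊥-elim (0≢0 refl)

  sign-1 : sign 1# ≡ ℤ.- (ℤ.+ 1)
  sign-1 with 1# ≟ 0#
  ... | yes 1≡0 = ⊥-elim (1≢0 1≡0)
  ... | no  _   = refl

  sign-+ : ∀ {x y} → IsBit x → IsBit y → sign (x + y) ≡ sign x ℤ.* sign y
  sign-+ (inj₁ refl) (inj₁ refl) = trans (cong sign (+-identityˡ 0#)) (trans sign-0 (sym (cong₂ ℤ._*_ sign-0 sign-0)))
  sign-+ (inj₁ refl) (inj₂ refl) = trans (cong sign (+-identityˡ 1#)) (trans sign-1 (sym (cong₂ ℤ._*_ sign-0 sign-1)))
  sign-+ (inj₂ refl) (inj₁ refl) = trans (cong sign (+-identityʳ 1#)) (trans sign-1 (sym (cong₂ ℤ._*_ sign-1 sign-0)))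
  sign-+ (inj₂ refl) (inj₂ refl) = trans (cong sign char2) (trans sign-0 (sym (cong₂ ℤ._*_ sign-1 sign-1)))

  sign-+1 : ∀ {x} → IsBit x → sign (x + 1#) ≡ ℤ.- sign x
  sign-+1 (inj₁ refl) = trans (cong sign (+-identityˡ 1#)) (trans sign-1 (cong ℤ.-_ (sym sign-0)))
  sign-+1 (inj₂ refl) = trans (cong sign char2) (trans sign-0 (cong ℤ.-_ (sym sign-1)))

module SumSplitting {c ℓ} (M : CommutativeMonoid c ℓ) where
  open CommutativeMonoid M using (Carrier; _≈_; _∙_; ∙-congˡ; identityˡ; assoc; isEquivalence)
  open import Relation.Binary.Structures using (IsEquivalence)
  open IsEquivalence isEquivalence using () renaming (refl to ≈-refl; sym to ≈-sym; trans to ≈-trans)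
  open import Algebra.Properties.CommutativeMonoid.Sum M using (sum)

  sum-↑ : ∀ a {b} (f : Fin (a ℕ.+ b) → Carrier) → sum f ≈ sum (f ∘ (_↑ˡ b)) ∙ sum (f ∘ (a ↑ʳ_))
  sum-↑ zero    f = ≈-sym (identityˡ _)
  sum-↑ (suc a) f = ≈-trans (∙-congˡ (sum-↑ a (f ∘ suc))) (≈-sym (assoc _ _ _))

  sum-combine : ∀ a b (f : Fin (a ℕ.* b) → Carrier) → sum f ≈ sum (λ i → sum (λ j → f (combine {a} {b} i j)))
  sum-combine zero    b f = ≈-refl
  sum-combine (suc a) b f = ≈-trans (sum-↑ b f) (∙-congˡ (sum-combine a b (f ∘ (b ↑ʳ_))))

module DisjointSubsets where

  Disjoint : ∀ {n} → Subset n → Subset n → Set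
  Disjoint A B = ∀ {i} → i ∈ A → i ∈ B → ⊥

  private
    tails : ∀ {n x y} {A B : Subset n} → Disjoint (x ∷ A) (y ∷ B) → Disjoint A B
    tails disj a b = disj (there a) (there b)

  ∣A∣+∣B∣≤n : ∀ {n} (A B : Subset n) → Disjoint A B → ∣ A ∣ ℕ.+ ∣ B ∣ ≤ n
  ∣A∣+∣B∣≤n []          []          _    = z≤n
  ∣A∣+∣B∣≤n (true  ∷ A) (true  ∷ B) disj = ⊥-elim (disj here here)
  ∣A∣+∣B∣≤n (true  ∷ A) (false ∷ B) disj = s≤s (∣A∣+∣B∣≤n A B (tails disj))
  ∣A∣+∣B∣≤n {suc n} (false ∷ A) (true  ∷ B) disj =
    subst (_≤ suc n) (sym (ℕP.+-suc ∣ A ∣ ∣ B ∣)) (s≤s (∣A∣+∣B∣≤n A B (tails disj)))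
  ∣A∣+∣B∣≤n (false ∷ A) (false ∷ B) disj = ℕP.m≤n⇒m≤1+n (∣A∣+∣B∣≤n A B (tails disj))

  covering : ∀ {n} (A B : Subset n) → Disjoint A B → ∣ A ∣ ℕ.+ ∣ B ∣ ≡ n → ∀ i → i ∈ A ⊎ i ∈ B
  covering (true  ∷ A) (true  ∷ B) disj _ _ = ⊥-elim (disj here here)
  covering (true  ∷ A) (false ∷ B) disj _ zero = inj₁ here
  covering (false ∷ A) (true  ∷ B) disj _ zero = inj₂ here
  covering (true  ∷ A) (false ∷ B) disj card (suc i) =
    ⊎-map there there (covering A B (tails disj) (ℕP.suc-injective card) i)
  covering (false ∷ A) (true  ∷ B) disj card (suc i) =
    ⊎-map there there (covering A B (tails disj) (ℕP.suc-injective (trans (sym (ℕP.+-suc ∣ A ∣ ∣ B ∣)) card)) i)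
  covering (false ∷ A) (false ∷ B) disj card i =
    ⊥-elim (ℕP.<-irrefl refl (ℕP.≤-trans (ℕP.≤-reflexive (sym card)) (∣A∣+∣B∣≤n A B (tails disj))))

module IntegerSums where
  open import Algebra.Properties.Semiring.Sum ℤP.+-*-semiring public
    using (sum; sum-cong-≗; sum-replicate-zero; ∑-distrib-+; ∑-comm; sum-permute; *-distribˡ-sum)
  open SumSplitting ℤP.+-0-commutativeMonoid public

  indicator : ∀ {N} → Subset N → (Fin N → ℤ) → Fin N → ℤ
  indicator R g i = if ⌊ i ∈? R ⌋ then g i else ℤ.+ 0

  foldr-tabulate : ∀ {N} (g : Fin N → ℤ) → foldr ℤ._+_ (ℤ.+ 0) (tabulate g) ≡ sum g
  foldr-tabulate {zero}  g = refl
  foldr-tabulate {suc N} g = cong (ℤ._+_ (g zero)) (foldr-tabulate (g ∘ suc))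

  sumFin≡sum : ∀ N (g : Fin N → ℤ) → sumFin N g ≡ sum g
  sumFin≡sum N g = trans (cong (foldr ℤ._+_ (ℤ.+ 0)) (map-tabulate (λ i → i) g)) (foldr-tabulate g)

  sumSub≡sum : ∀ {N} (R : Subset N) (g : Fin N → ℤ) → sumSub R g ≡ sum (indicator R g)
  sumSub≡sum {N} R g = sumFin≡sum N (indicator R g)

  sum-neg : ∀ {N} (f : Fin N → ℤ) → sum (λ i → ℤ.- f i) ≡ ℤ.- sum f
  sum-neg {zero}  f = refl
  sum-neg {suc N} f = trans (cong (ℤ._+_ (ℤ.- f zero)) (sum-neg (f ∘ suc))) (sym (ℤP.neg-distrib-+ (f zero) _))

  indicator-affine : ∀ {N} (R : Subset N) c (X Y : Fin N → ℤ) →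
    sum (indicator R (λ i → c ℤ.* X i ℤ.- Y i)) ≡ c ℤ.* sum (indicator R X) ℤ.- sum (indicator R Y)
  indicator-affine R c X Y = begin
    sum (indicator R (λ i → c ℤ.* X i ℤ.- Y i))                                    ≡⟨ sum-cong-≗ pointwise ⟩
    sum (λ i → c ℤ.* indicator R X i ℤ.+ ℤ.- indicator R Y i)                       ≡⟨ ∑-distrib-+ (λ i → c ℤ.* indicator R X i) (λ i → ℤ.- indicator R Y i) ⟩
    sum (λ i → c ℤ.* indicator R X i) ℤ.+ sum (λ i → ℤ.- indicator R Y i)           ≡⟨ cong₂ ℤ._+_ (sym (*-distribˡ-sum c (indicator R X))) (sum-neg (indicator R Y)) ⟩
    c ℤ.* sum (indicator R X) ℤ.- sum (indicator R Y)                              ∎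
    where
    open ≡-Reasoning
    pointwise : ∀ i → indicator R (λ i → c ℤ.* X i ℤ.- Y i) i ≡ c ℤ.* indicator R X i ℤ.- indicator R Y i
    pointwise i with i ∈? R
    ... | yes _ = refl
    ... | no  _ = cong (ℤ._- ℤ.+ 0) (sym (ℤP.*-zeroʳ c))

  sum-at : ∀ {N} (s : Fin N) (v : Fin N → ℤ) → sum (λ i → if ⌊ i FinP.≟ s ⌋ then v i else ℤ.+ 0) ≡ v s
  sum-at {suc N} zero    v = trans (cong (ℤ._+_ (v zero)) (sum-replicate-zero N)) (ℤP.+-identityʳ _)
  sum-at {suc N} (suc s) v = trans (ℤP.+-identityˡ _) (trans (sum-cong-≗ shift) (sum-at s (v ∘ suc)))
    where
    shift : ∀ i → (if ⌊ suc i FinP.≟ suc s ⌋ then v (suc i) else ℤ.+ 0) ≡ (if ⌊ i FinP.≟ s ⌋ then v (suc i) else ℤ.+ 0)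
    shift i with i FinP.≟ s
    ... | yes refl = refl
    ... | no  _    = refl

  indicator-∈ : ∀ {N} {R : Subset N} {X : Fin N → ℤ} {i} → i ∈ R → indicator R X i ≡ X i
  indicator-∈ {R = R} {i = i} i∈R with i ∈? R
  ... | yes _   = refl
  ... | no  i∉R = ⊥-elim (i∉R i∈R)

  indicator-∉ : ∀ {N} {R : Subset N} {X : Fin N → ℤ} {i} → ¬ i ∈ R → indicator R X i ≡ ℤ.+ 0
  indicator-∉ {R = R} {i = i} i∉R with i ∈? R
  ... | yes i∈R = ⊥-elim (i∉R i∈R)
  ... | no  _   = refl

  indicator-cong : ∀ {N} (R : Subset N) {X Y : Fin N → ℤ} → (∀ i → i ∈ R → X i ≡ Y i) → ∀ i → indicator R X i ≡ indicator R Y i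
  indicator-cong R X≡Y i with i ∈? R
  ... | yes i∈R = X≡Y i i∈R
  ... | no  _   = refl

  δ : ∀ {N} → Fin N → Fin N → ℤ
  δ s i = if ⌊ i FinP.≟ s ⌋ then ℤ.+ 1 else ℤ.+ 0

  sum-indicator-δ : ∀ {N} (R : Subset N) (X : Fin N → ℤ) s → sum (indicator R (λ i → X i ℤ.* δ s i)) ≡ indicator R X s
  sum-indicator-δ R X s = trans (sum-cong-≗ pointwise) (sum-at s (indicator R X))
    where
    pointwise : ∀ i → indicator R (λ i → X i ℤ.* δ s i) i ≡ (if ⌊ i FinP.≟ s ⌋ then indicator R X i else ℤ.+ 0)
    pointwise i with i ∈? R | i FinP.≟ s
    ... | yes _ | yes _ = ℤP.*-identityʳ (X i)
    ... | yes _ | no  _ = ℤP.*-zeroʳ (X i)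
    ... | no  _ | yes _ = refl
    ... | no  _ | no  _ = refl

  open DisjointSubsets

  indicator-partition : ∀ {N} {R₀ R₁ : Subset N} → Disjoint R₀ R₁ → (∀ i → i ∈ R₀ ⊎ i ∈ R₁) →
    ∀ {X Y : Fin N → ℤ} {w} i → (i ∈ R₀ → w ≡ X i) → (i ∈ R₁ → w ≡ Y i) → w ≡ indicator R₀ X i ℤ.+ indicator R₁ Y i
  indicator-partition {R₀ = R₀} {R₁} disjoint cover i onR₀ onR₁ with i ∈? R₀ | i ∈? R₁
  ... | yes i∈R₀ | yes i∈R₁ = ⊥-elim (disjoint i∈R₀ i∈R₁)
  ... | yes i∈R₀ | no  _    = trans (onR₀ i∈R₀) (sym (ℤP.+-identityʳ _))
  ... | no  _    | yes i∈R₁ = trans (onR₁ i∈R₁) (sym (ℤP.+-identityˡ _))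
  ... | no  i∉R₀ | no  i∉R₁ = ⊥-elim ([ i∉R₀ , i∉R₁ ]′ (cover i))

  ∣R∣≡sum-indicator : ∀ {N} (R : Subset N) → ℤ.+ ∣ R ∣ ≡ sum (indicator R (λ _ → ℤ.+ 1))
  ∣R∣≡sum-indicator {zero}  []      = refl
  ∣R∣≡sum-indicator {suc N} (x ∷ R) = trans (head+tail x) (cong (ℤ._+_ (indicator (x ∷ R) (λ _ → ℤ.+ 1) zero))
    (trans (∣R∣≡sum-indicator R) (sum-cong-≗ tail-indicator)))
    where
    head+tail : ∀ x → ℤ.+ ∣ x ∷ R ∣ ≡ indicator (x ∷ R) (λ _ → ℤ.+ 1) zero ℤ.+ ℤ.+ ∣ R ∣
    head+tail true  = refl
    head+tail false = refl
    tail-indicator : ∀ i → indicator R (λ _ → ℤ.+ 1) i ≡ indicator (x ∷ R) (λ _ → ℤ.+ 1) (suc i)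
    tail-indicator i with i ∈? R
    ... | yes _ = refl
    ... | no  _ = refl

injective⇒surjective : ∀ {m n} → m ≡ n → (f : Fin m → Fin n) → (∀ {i j} → f i ≡ f j → i ≡ j) →
                       ∀ y → ∃ λ i → f i ≡ y
injective⇒surjective {zero}  refl f inj ()
injective⇒surjective {suc n} refl f inj y with FinP.any? (λ i → f i FinP.≟ y)
... | yes found  = found
... | no  ¬found = ⊥-elim (ℕP.<-irrefl refl (FinP.injective⇒≤ avoid-y-injective))
  where
  avoid-y : Fin (suc n) → Fin n
  avoid-y i = Fin.punchOut {i = y} (λ e → ¬found (i , sym e))
  avoid-y-injective : ∀ {i j} → avoid-y i ≡ avoid-y j → i ≡ j
  avoid-y-injective {i} {j} e =
    inj (FinP.punchOut-injective (λ e′ → ¬found (i , sym e′)) (λ e′ → ¬found (j , sym e′)) e)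

module PrimitiveElement {k : ℕ} (F : GF2 k) (ω : GF2.Carrier F) (prim : GF2.IsPrimitive F ω)
                        .{{_ : NonZero (2 ℕ.^ k ∸ 1)}} where
  open CharacteristicTwo F
  open IntegerSums
  open ≡-Reasoning

  D : ℕ
  D = 2 ℕ.^ k ∸ 1

  1+D≡2^k : suc D ≡ 2 ℕ.^ k
  1+D≡2^k = ℕP.m+[n∸m]≡n {1} {2 ℕ.^ k} (ℕP.m^n>0 2 k)

  ω^D≡1 : ω ^ D ≡ 1#
  ω^D≡1 = proj₁ prim

  ω≢0 : ω ≢ 0#
  ω≢0 ω≡0 = 0≢1 (begin
    0#                      ≡⟨ 0^[1+a]≡0 (ℕ.pred D) ⟨
    0# ^ suc (ℕ.pred D)     ≡⟨ cong (λ x → x ^ suc (ℕ.pred D)) ω≡0 ⟨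
    ω ^ suc (ℕ.pred D)      ≡⟨ cong (ω ^_) (ℕP.suc-pred D) ⟩
    ω ^ D                   ≡⟨ ω^D≡1 ⟩
    1#                      ∎)

  ω-order : ∀ a → ω ^ a ≡ 1# → D ℕD.∣ a
  ω-order a ω^a≡1 = ℕD.m%n≡0⇒n∣m a D (remainder≡0 (a % D) (m%n<n a D) ω^[a%D]≡1)
    where
    open import Data.Nat.DivMod using (_%_; _/_; m≡m%n+[m/n]*n; m%n<n)
    ω^[a%D]≡1 : ω ^ (a % D) ≡ 1#
    ω^[a%D]≡1 = begin
      ω ^ (a % D)                           ≡⟨ *-identityʳ _ ⟨
      ω ^ (a % D) * 1#                      ≡⟨ cong (ω ^ (a % D) *_) (^-≡1 D ω^D≡1 (ℕD.n∣m*n (a / D))) ⟨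
      ω ^ (a % D) * ω ^ (a / D ℕ.* D)       ≡⟨ ^-homo-* ω (a % D) (a / D ℕ.* D) ⟨
      ω ^ (a % D ℕ.+ a / D ℕ.* D)           ≡⟨ cong (ω ^_) (m≡m%n+[m/n]*n a D) ⟨
      ω ^ a                                 ≡⟨ ω^a≡1 ⟩
      1#                                    ∎
    remainder≡0 : ∀ r → r < D → ω ^ r ≡ 1# → r ≡ 0
    remainder≡0 zero    _   _ = refl
    remainder≡0 (suc r) r<D e = ⊥-elim (proj₂ prim (suc r) z<s r<D e)

  ω-injective : ∀ {a b} → a < D → b < D → ω ^ a ≡ ω ^ b → a ≡ b
  ω-injective = ^-injective D ω≢0 ω-order

  power : Fin (suc D) → Carrier
  power zero    = 0#
  power (suc j) = ω ^ toℕ j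

  power-injective : ∀ {i j} → power i ≡ power j → i ≡ j
  power-injective {zero}  {zero}  _ = refl
  power-injective {zero}  {suc j} e = ⊥-elim (^-≢0 (toℕ j) ω≢0 (sym e))
  power-injective {suc i} {zero}  e = ⊥-elim (^-≢0 (toℕ i) ω≢0 e)
  power-injective {suc i} {suc j} e = cong suc (FinP.toℕ-injective (ω-injective (FinP.toℕ<n i) (FinP.toℕ<n j) e))

  private
    index : Fin (suc D) → Fin (2 ℕ.^ k)
    index = Inverse.from enum ∘ power

    to∘index≡power : ∀ i → Inverse.to enum (index i) ≡ power i
    to∘index≡power i = Inverse.strictlyInverseˡ enum (power i)

    index-injective : ∀ {i j} → index i ≡ index j → i ≡ j
    index-injective {i} {j} e =
      power-injective (trans (sym (to∘index≡power i)) (trans (cong (Inverse.to enum) e) (to∘index≡power j)))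

    index-surjective : ∀ y → ∃ λ i → index i ≡ y
    index-surjective = injective⇒surjective 1+D≡2^k index index-injective

    indexing : Permutation (suc D) (2 ℕ.^ k)
    indexing = mk↔ₛ′ index (proj₁ ∘ index-surjective) (proj₂ ∘ index-surjective)
                     (λ i → index-injective (proj₂ (index-surjective (index i))))

  power-surjective : ∀ x → ∃ λ i → power i ≡ x
  power-surjective x with index-surjective (Inverse.from enum x)
  ... | i , e = i , trans (sym (to∘index≡power i))
                      (trans (cong (Inverse.to enum) e) (Inverse.strictlyInverseˡ enum x))

  discrete-log : ∀ {x} → x ≢ 0# → ∃ λ j → j < D × ω ^ j ≡ x
  discrete-log {x} x≢0 with power-surjective x
  ... | zero  , 0≡x = ⊥-elim (x≢0 (sym 0≡x))
  ... | suc j , e   = toℕ j , FinP.toℕ<n j , e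

  sumF-powers : ∀ (h : Carrier → ℤ) → sumF h ≡ h 0# ℤ.+ sum (λ (j : Fin D) → h (ω ^ toℕ j))
  sumF-powers h = begin
    sumF h                                  ≡⟨ sumFin≡sum (2 ℕ.^ k) (h ∘ Inverse.to enum) ⟩
    sum (h ∘ Inverse.to enum)               ≡⟨ sum-permute (h ∘ Inverse.to enum) indexing ⟩
    sum (h ∘ Inverse.to enum ∘ index)       ≡⟨ sum-cong-≗ (cong h ∘ to∘index≡power) ⟩
    sum (h ∘ power)                         ∎

  x^[1+D]≡x : ∀ x → x ^ suc D ≡ x
  x^[1+D]≡x x with x ≟ 0#
  ... | yes refl = 0^[1+a]≡0 D
  ... | no  x≢0 with discrete-log x≢0
  ...   | j , _ , refl = begin
    ω ^ j * (ω ^ j) ^ D     ≡⟨ cong (ω ^ j *_) (^-comm ω j D) ⟩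
    ω ^ j * (ω ^ D) ^ j     ≡⟨ cong (λ y → ω ^ j * y ^ j) ω^D≡1 ⟩
    ω ^ j * 1# ^ j          ≡⟨ cong (ω ^ j *_) (1^a≡1 j) ⟩
    ω ^ j * 1#              ≡⟨ *-identityʳ _ ⟩
    ω ^ j                   ∎

module QuadraticExtension (m′ : ℕ) (F : GF2 (2 ℕ.* suc m′)) (ω : GF2.Carrier F) (prim : GF2.IsPrimitive F ω) where
  open CharacteristicTwo F public
  open ArithmeticOfq
  open ≡-Reasoning

  m n p q : ℕ
  m = suc m′
  n = 2 ℕ.* m
  p = 2 ℕ.^ m′
  q = 2 ℕ.^ m

  instance
    p≢0 : NonZero p
    p≢0 = ℕP.m^n≢0 2 m′

  q∸1≡1+2[p∸1] : q ∸ 1 ≡ suc (2 ℕ.* (p ∸ 1))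
  q∸1≡1+2[p∸1] = 2p∸1≡1+2[p∸1] p

  instance
    q∸1≢0 : NonZero (q ∸ 1)
    q∸1≢0 = subst NonZero (sym q∸1≡1+2[p∸1]) _

    q+1≢0 : NonZero (q ℕ.+ 1)
    q+1≢0 = subst NonZero (ℕP.+-comm 1 q) _

  2≤q : 2 ≤ q
  2≤q = ℕP.*-monoʳ-≤ 2 (ℕP.m^n>0 2 m′)

  1+[q∸2]≡q∸1 : suc (q ∸ 2) ≡ q ∸ 1
  1+[q∸2]≡q∸1 = sym (ℕP.+-∸-assoc 1 2≤q)

  2^n≡q*q : 2 ℕ.^ n ≡ q ℕ.* q
  2^n≡q*q = trans (ℕP.^-distribˡ-+-* 2 m (m ℕ.+ 0)) (cong (λ e → q ℕ.* 2 ℕ.^ e) (ℕP.+-identityʳ m))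

  2^n∸1≡[q∸1]*[q+1] : 2 ℕ.^ n ∸ 1 ≡ (q ∸ 1) ℕ.* (q ℕ.+ 1)
  2^n∸1≡[q∸1]*[q+1] = trans (cong (_∸ 1) 2^n≡q*q) (sym (q∸1*q+1≡q*q∸1 p))

  2^n∸1≡[q+1]*[q∸1] : 2 ℕ.^ n ∸ 1 ≡ (q ℕ.+ 1) ℕ.* (q ∸ 1)
  2^n∸1≡[q+1]*[q∸1] = trans 2^n∸1≡[q∸1]*[q+1] (ℕP.*-comm (q ∸ 1) (q ℕ.+ 1))

  instance
    2^n∸1≢0 : NonZero (2 ℕ.^ n ∸ 1)
    2^n∸1≢0 = subst NonZero (sym 2^n∸1≡[q∸1]*[q+1]) (ℕP.m*n≢0 (q ∸ 1) (q ℕ.+ 1))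

  open PrimitiveElement F ω prim public

  -- (q ∸ 1) * c ≡ 1 + (q + 1) * e is what makes u = ω ^ ((q ∸ 1) * c) a generator of μ_(q+1).
  c e : ℕ
  c = 2 ℕ.^ (n ∸ 1) ∸ 1
  e = q ℕ.* (p ∸ 1)

  [q∸1]*c≡1+[q+1]*e : (q ∸ 1) ℕ.* c ≡ 1 ℕ.+ (q ℕ.+ 1) ℕ.* e
  [q∸1]*c≡1+[q+1]*e = trans (cong (λ z → (q ∸ 1) ℕ.* (z ∸ 1)) 2^[n∸1]≡p*q) (q∸1*[pq∸1]≡1+[q+1]*e p)
    where
    2^[n∸1]≡p*q : 2 ℕ.^ (n ∸ 1) ≡ p ℕ.* q
    2^[n∸1]≡p*q = trans (ℕP.^-distribˡ-+-* 2 m′ (suc (m′ ℕ.+ 0)))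
                        (cong (λ z → p ℕ.* 2 ℕ.^ suc z) (ℕP.+-identityʳ m′))

  u g : Carrier
  u = ω ^ ((q ∸ 1) ℕ.* c)
  g = ω ^ (q ℕ.+ 1)

  u≢0 : u ≢ 0#
  u≢0 = ^-≢0 ((q ∸ 1) ℕ.* c) ω≢0

  g≢0 : g ≢ 0#
  g≢0 = ^-≢0 (q ℕ.+ 1) ω≢0

  q+1∣D : (q ℕ.+ 1) ℕD.∣ D
  q+1∣D = subst ((q ℕ.+ 1) ℕD.∣_) (sym 2^n∸1≡[q∸1]*[q+1]) (ℕD.n∣m*n (q ∸ 1))

  u^[q+1]≡1 : u ^ (q ℕ.+ 1) ≡ 1#
  u^[q+1]≡1 = begin
    u ^ (q ℕ.+ 1)                                 ≡⟨ ^-assocʳ ω ((q ∸ 1) ℕ.* c) (q ℕ.+ 1) ⟩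
    ω ^ ((q ∸ 1) ℕ.* c ℕ.* (q ℕ.+ 1))             ≡⟨ cong (ω ^_) (rearrange (q ∸ 1) c (q ℕ.+ 1)) ⟩
    ω ^ (c ℕ.* ((q ∸ 1) ℕ.* (q ℕ.+ 1)))           ≡⟨ ^-≡1 D ω^D≡1 (subst (ℕD._∣ c ℕ.* ((q ∸ 1) ℕ.* (q ℕ.+ 1))) (sym 2^n∸1≡[q∸1]*[q+1]) (ℕD.n∣m*n c)) ⟩
    1#                                            ∎
    where
    rearrange : ∀ a b d → a ℕ.* b ℕ.* d ≡ b ℕ.* (a ℕ.* d)
    rearrange = solve-∀

  u-order : ∀ a → u ^ a ≡ 1# → (q ℕ.+ 1) ℕD.∣ a
  u-order a u^a≡1 = ℕD.∣m+n∣m⇒∣n (subst ((q ℕ.+ 1) ℕD.∣_) expand q+1∣exponent) (ℕD.m∣m*n (e ℕ.* a))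
    where
    q+1∣exponent : (q ℕ.+ 1) ℕD.∣ (q ∸ 1) ℕ.* c ℕ.* a
    q+1∣exponent = ℕD.∣-trans q+1∣D (ω-order _ (trans (sym (^-assocʳ ω ((q ∸ 1) ℕ.* c) a)) u^a≡1))
    expand : (q ∸ 1) ℕ.* c ℕ.* a ≡ (q ℕ.+ 1) ℕ.* (e ℕ.* a) ℕ.+ a
    expand = trans (cong (ℕ._* a) [q∸1]*c≡1+[q+1]*e) (distribute (q ℕ.+ 1) e a)
      where
      distribute : ∀ Q e a → (1 ℕ.+ Q ℕ.* e) ℕ.* a ≡ Q ℕ.* (e ℕ.* a) ℕ.+ a
      distribute = solve-∀

  u-injective : ∀ {a b} → a < q ℕ.+ 1 → b < q ℕ.+ 1 → u ^ a ≡ u ^ b → a ≡ b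
  u-injective = ^-injective (q ℕ.+ 1) u≢0 u-order

  g^[q∸1]≡1 : g ^ (q ∸ 1) ≡ 1#
  g^[q∸1]≡1 = begin
    g ^ (q ∸ 1)                      ≡⟨ ^-assocʳ ω (q ℕ.+ 1) (q ∸ 1) ⟩
    ω ^ ((q ℕ.+ 1) ℕ.* (q ∸ 1))      ≡⟨ cong (ω ^_) (trans (ℕP.*-comm (q ℕ.+ 1) (q ∸ 1)) (sym 2^n∸1≡[q∸1]*[q+1])) ⟩
    ω ^ D                            ≡⟨ ω^D≡1 ⟩
    1#                               ∎

  g-order : ∀ a → g ^ a ≡ 1# → (q ∸ 1) ℕD.∣ a
  g-order a g^a≡1 = ℕD.*-cancelˡ-∣ (q ℕ.+ 1) (subst (ℕD._∣ (q ℕ.+ 1) ℕ.* a) 2^n∸1≡[q+1]*[q∸1] D∣[q+1]a)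
    where
    D∣[q+1]a : D ℕD.∣ (q ℕ.+ 1) ℕ.* a
    D∣[q+1]a = ω-order _ (trans (sym (^-assocʳ ω (q ℕ.+ 1) a)) g^a≡1)

  g-injective : ∀ {a b} → a < q ∸ 1 → b < q ∸ 1 → g ^ a ≡ g ^ b → a ≡ b
  g-injective = ^-injective (q ∸ 1) g≢0 g-order

  -- Each x = ω ^ ((q + 1) k + l) lies in the coset u ^ l F_q^*: the shift
  -- makes the exponents agree up to the period D.
  shift : ℕ → ℕ
  shift l = (q ∸ 2) ℕ.* l ℕ.* e

  coset-exponent : ∀ k l → (q ∸ 1) ℕ.* c ℕ.* l ℕ.+ (q ℕ.+ 1) ℕ.* (k ℕ.+ shift l)
                         ≡ ((q ℕ.+ 1) ℕ.* k ℕ.+ l) ℕ.+ l ℕ.* e ℕ.* D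
  coset-exponent k l = begin
    (q ∸ 1) ℕ.* c ℕ.* l ℕ.+ Q ℕ.* (k ℕ.+ shift l)        ≡⟨ cong (λ z → z ℕ.* l ℕ.+ Q ℕ.* (k ℕ.+ shift l)) [q∸1]*c≡1+[q+1]*e ⟩
    (1 ℕ.+ Q ℕ.* e) ℕ.* l ℕ.+ Q ℕ.* (k ℕ.+ shift l)      ≡⟨ identity Q e (q ∸ 2) k l ⟩
    (Q ℕ.* k ℕ.+ l) ℕ.+ l ℕ.* e ℕ.* (suc (q ∸ 2) ℕ.* Q)  ≡⟨ cong (λ z → (Q ℕ.* k ℕ.+ l) ℕ.+ l ℕ.* e ℕ.* (z ℕ.* Q)) 1+[q∸2]≡q∸1 ⟩
    (Q ℕ.* k ℕ.+ l) ℕ.+ l ℕ.* e ℕ.* ((q ∸ 1) ℕ.* Q)      ≡⟨ cong (λ z → (Q ℕ.* k ℕ.+ l) ℕ.+ l ℕ.* e ℕ.* z) 2^n∸1≡[q∸1]*[q+1] ⟨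
    (Q ℕ.* k ℕ.+ l) ℕ.+ l ℕ.* e ℕ.* D                    ∎
    where
    Q = q ℕ.+ 1
    identity : ∀ Q e s k l → (1 ℕ.+ Q ℕ.* e) ℕ.* l ℕ.+ Q ℕ.* (k ℕ.+ s ℕ.* l ℕ.* e)
                           ≡ (Q ℕ.* k ℕ.+ l) ℕ.+ l ℕ.* e ℕ.* (suc s ℕ.* Q)
    identity = solve-∀

  ω^-coset : ∀ k l → ω ^ ((q ℕ.+ 1) ℕ.* k ℕ.+ l) ≡ u ^ l * g ^ (k ℕ.+ shift l)
  ω^-coset k l = begin
    ω ^ ((q ℕ.+ 1) ℕ.* k ℕ.+ l)                                       ≡⟨ ^-≡-∸ D ω^D≡1 (ℕP.m≤m+n ((q ℕ.+ 1) ℕ.* k ℕ.+ l) (l ℕ.* e ℕ.* D)) D∣ ⟨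
    ω ^ (((q ℕ.+ 1) ℕ.* k ℕ.+ l) ℕ.+ l ℕ.* e ℕ.* D)                   ≡⟨ cong (ω ^_) (coset-exponent k l) ⟨
    ω ^ ((q ∸ 1) ℕ.* c ℕ.* l ℕ.+ (q ℕ.+ 1) ℕ.* (k ℕ.+ shift l))       ≡⟨ ^-homo-* ω ((q ∸ 1) ℕ.* c ℕ.* l) ((q ℕ.+ 1) ℕ.* (k ℕ.+ shift l)) ⟩
    ω ^ ((q ∸ 1) ℕ.* c ℕ.* l) * ω ^ ((q ℕ.+ 1) ℕ.* (k ℕ.+ shift l))   ≡⟨ cong₂ _*_ (^-assocʳ ω ((q ∸ 1) ℕ.* c) l) (^-assocʳ ω (q ℕ.+ 1) (k ℕ.+ shift l)) ⟨
    u ^ l * g ^ (k ℕ.+ shift l)                                       ∎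
    where
    D∣ : D ℕD.∣ ((q ℕ.+ 1) ℕ.* k ℕ.+ l) ℕ.+ l ℕ.* e ℕ.* D ∸ ((q ℕ.+ 1) ℕ.* k ℕ.+ l)
    D∣ = subst (D ℕD.∣_) (sym (ℕP.m+n∸m≡n ((q ℕ.+ 1) ℕ.* k ℕ.+ l) (l ℕ.* e ℕ.* D))) (ℕD.n∣m*n (l ℕ.* e))

  Fq : Carrier → Set
  Fq y = y ^ q ≡ y

  Fq-0 : Fq 0#
  Fq-0 = subst (λ z → 0# ^ z ≡ 0#) (ℕP.suc-pred q {{ℕP.m^n≢0 2 m}}) (0^[1+a]≡0 (ℕ.pred q))

  Fq-+ : ∀ {x y} → Fq x → Fq y → Fq (x + y)
  Fq-+ {x} {y} x∈ y∈ = trans (frobenius-+ m x y) (cong₂ _+_ x∈ y∈)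

  Fq-* : ∀ {x y} → Fq x → Fq y → Fq (x * y)
  Fq-* {x} {y} x∈ y∈ = trans (^-distrib-* x y q) (cong₂ _*_ x∈ y∈)

  Fq-^ : ∀ {x} j → Fq x → Fq (x ^ j)
  Fq-^ {x} j x∈ = trans (^-comm x j q) (cong (_^ j) x∈)

  Fq-⁻¹ : ∀ {x} → x ≢ 0# → Fq x → Fq (x ⁻¹)
  Fq-⁻¹ {x} x≢0 x∈ = ⁻¹-unique x ((x ⁻¹) ^ q) (begin
    x * (x ⁻¹) ^ q          ≡⟨ cong (_* (x ⁻¹) ^ q) x∈ ⟨
    x ^ q * (x ⁻¹) ^ q      ≡⟨ ^-distrib-* x (x ⁻¹) q ⟨
    (x * x ⁻¹) ^ q          ≡⟨ cong (_^ q) (inverse x x≢0) ⟩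
    1# ^ q                  ≡⟨ 1^a≡1 q ⟩
    1#                      ∎)

  x^[q*q]≡x : ∀ x → x ^ (q ℕ.* q) ≡ x
  x^[q*q]≡x x = trans (cong (x ^_) (trans (sym 2^n≡q*q) (sym 1+D≡2^k))) (x^[1+D]≡x x)

  Fq-x+x^q : ∀ x → Fq (x + x ^ q)
  Fq-x+x^q x = begin
    (x + x ^ q) ^ q          ≡⟨ frobenius-+ m x (x ^ q) ⟩
    x ^ q + (x ^ q) ^ q      ≡⟨ cong (x ^ q +_) (trans (^-assocʳ x q q) (x^[q*q]≡x x)) ⟩
    x ^ q + x                ≡⟨ +-comm _ x ⟩
    x + x ^ q                ∎

  Fq-g^ : ∀ j → Fq (g ^ j)
  Fq-g^ j = Fq-^ j g∈
    where
    g∈ : Fq g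
    g∈ = begin
      g ^ q                    ≡⟨ cong (g ^_) 1+[q∸1]≡q ⟨
      g * g ^ (q ∸ 1)          ≡⟨ cong (g *_) g^[q∸1]≡1 ⟩
      g * 1#                   ≡⟨ *-identityʳ g ⟩
      g                        ∎
      where
      1+[q∸1]≡q : suc (q ∸ 1) ≡ q
      1+[q∸1]≡q = ℕP.suc-pred q {{ℕP.m^n≢0 2 m}}

  [u^t]^q≡[u^t]⁻¹ : ∀ t → (u ^ t) ^ q ≡ (u ^ t) ⁻¹
  [u^t]^q≡[u^t]⁻¹ t = ⁻¹-unique (u ^ t) ((u ^ t) ^ q) (begin
    (u ^ t) ^ suc q          ≡⟨ cong ((u ^ t) ^_) (ℕP.+-comm 1 q) ⟩
    (u ^ t) ^ (q ℕ.+ 1)      ≡⟨ ^-comm u t (q ℕ.+ 1) ⟩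
    (u ^ (q ℕ.+ 1)) ^ t      ≡⟨ cong (_^ t) u^[q+1]≡1 ⟩
    1# ^ t                   ≡⟨ 1^a≡1 t ⟩
    1#                       ∎)

  [x*u^t]^q : ∀ x t → (x * u ^ t) ^ q ≡ x ^ q * (u ^ t) ⁻¹
  [x*u^t]^q x t = trans (^-distrib-* x (u ^ t) q) (cong (x ^ q *_) ([u^t]^q≡[u^t]⁻¹ t))

  trace-n≡trace-m : ∀ a {z} → Fq z → trace n (a * z) ≡ trace m ((a + a ^ q) * z)
  trace-n≡trace-m a {z} z∈ = begin
    trace n (a * z)                                   ≡⟨ trace-+-split m (m ℕ.+ 0) (a * z) ⟩
    trace m (a * z) + trace (m ℕ.+ 0) ((a * z) ^ q)   ≡⟨ cong₂ (λ j w → trace m (a * z) + trace j w) (ℕP.+-identityʳ m) [az]^q ⟩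
    trace m (a * z) + trace m (a ^ q * z)             ≡⟨ trace-+ m (a * z) (a ^ q * z) ⟨
    trace m (a * z + a ^ q * z)                       ≡⟨ cong (trace m) (distribʳ z a (a ^ q)) ⟨
    trace m ((a + a ^ q) * z)                         ∎
    where
    [az]^q : (a * z) ^ q ≡ a ^ q * z
    [az]^q = trans (^-distrib-* a z q) (cong (a ^ q *_) z∈)

  Fq-trace-^2 : ∀ {z} → Fq z → trace m (z ^ 2) ≡ trace m z
  Fq-trace-^2 {z} z∈ = +-cancelˡ z (trace m (z ^ 2)) (trace m z) (begin
    z + trace m (z ^ 2)          ≡⟨ cong (_+ trace m (z ^ 2)) (trans (+-identityˡ _) (x^1≡x z)) ⟨
    trace 1 z + trace m (z ^ 2)  ≡⟨ trace-+-split 1 m z ⟨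
    trace (suc m) z              ≡⟨ cong (trace m z +_) z∈ ⟩
    trace m z + z                ≡⟨ +-comm _ z ⟩
    z + trace m z                ∎)

  Fq-trace-^2^t : ∀ t {z} → Fq z → trace m (z ^ (2 ℕ.^ t)) ≡ trace m z
  Fq-trace-^2^t zero    {z} z∈ = cong (trace m) (x^1≡x z)
  Fq-trace-^2^t (suc t) {z} z∈ = begin
    trace m (z ^ (2 ℕ.* 2 ℕ.^ t))     ≡⟨ cong (trace m) (^-assocʳ z 2 (2 ℕ.^ t)) ⟨
    trace m ((z ^ 2) ^ (2 ℕ.^ t))     ≡⟨ Fq-trace-^2^t t (Fq-^ 2 z∈) ⟩
    trace m (z ^ 2)                   ≡⟨ Fq-trace-^2 z∈ ⟩
    trace m z                         ∎

  Fq-trace-IsBit : ∀ {z} → Fq z → IsBit (trace m z)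
  Fq-trace-IsBit {z} z∈ = x^2≡x⇒IsBit (trans (trace-frobenius m z) (Fq-trace-^2 z∈))

  module Σ𝔽 = Algebra.Properties.Semiring.Sum (CommutativeRing.semiring commutativeRing)

  trace-as-sum : ∀ j w → trace j w ≡ Σ𝔽.sum (λ (i : Fin j) → w ^ (2 ℕ.^ toℕ i))
  trace-as-sum zero    w = refl
  trace-as-sum (suc j) w = begin
    trace j w + w ^ (2 ℕ.^ j)                                                   ≡⟨ cong₂ _+_ (trans (trace-as-sum j w) (Σ𝔽.sum-cong-≗ init≗)) last≡ ⟩
    Σ𝔽.sum (λ i → t (Fin.inject₁ i)) + t (Fin.fromℕ j)                           ≡⟨ Σ𝔽.sum-init-last t ⟨
    Σ𝔽.sum t                                                                    ∎
    where
    t : Fin (suc j) → Carrier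
    t i = w ^ (2 ℕ.^ toℕ i)
    init≗ : ∀ i → w ^ (2 ℕ.^ toℕ i) ≡ t (Fin.inject₁ i)
    init≗ i = cong (λ z → w ^ (2 ℕ.^ z)) (sym (FinP.toℕ-inject₁ i))
    last≡ : w ^ (2 ℕ.^ j) ≡ t (Fin.fromℕ j)
    last≡ = cong (λ z → w ^ (2 ℕ.^ z)) (sym (FinP.toℕ-fromℕ j))

  geometric-sum : ∀ h N → (1# + h) * Σ𝔽.sum (λ (i : Fin N) → h ^ toℕ i) ≡ 1# + h ^ N
  geometric-sum h zero    = trans (zeroʳ _) (sym char2)
  geometric-sum h (suc N) = begin
    (1# + h) * (1# + Σ𝔽.sum (λ (i : Fin N) → h * h ^ toℕ i))    ≡⟨ cong (λ z → (1# + h) * (1# + z)) (Σ𝔽.*-distribˡ-sum h (λ (i : Fin N) → h ^ toℕ i)) ⟨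
    (1# + h) * (1# + h * S)                          ≡⟨ distribˡ (1# + h) 1# (h * S) ⟩
    (1# + h) * 1# + (1# + h) * (h * S)               ≡⟨ cong₂ _+_ (*-identityʳ _) rotate ⟩
    (1# + h) + h * ((1# + h) * S)                    ≡⟨ cong (λ z → (1# + h) + h * z) (geometric-sum h N) ⟩
    (1# + h) + h * (1# + h ^ N)                      ≡⟨ cong ((1# + h) +_) (trans (distribˡ h 1# (h ^ N)) (cong (_+ h ^ suc N) (*-identityʳ h))) ⟩
    (1# + h) + (h + h ^ suc N)                       ≡⟨ +-assoc 1# h _ ⟩
    1# + (h + (h + h ^ suc N))                       ≡⟨ cong (1# +_) (+-assoc h h _) ⟨
    1# + ((h + h) + h ^ suc N)                       ≡⟨ cong (λ z → 1# + (z + h ^ suc N)) (x+x≡0 h) ⟩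
    1# + (0# + h ^ suc N)                            ≡⟨ cong (1# +_) (+-identityˡ _) ⟩
    1# + h ^ suc N                                   ∎
    where
    S = Σ𝔽.sum (λ (i : Fin N) → h ^ toℕ i)
    rotate : (1# + h) * (h * S) ≡ h * ((1# + h) * S)
    rotate = trans (sym (*-assoc _ h S)) (trans (cong (_* S) (*-comm _ h)) (*-assoc h _ S))

  geometric-sum-period : ∀ {h} N → h ^ N ≡ 1# → h ≢ 1# → Σ𝔽.sum (λ (i : Fin N) → h ^ toℕ i) ≡ 0#
  geometric-sum-period {h} N h^N≡1 h≢1
    with x*y≡0⇒x≡0⊎y≡0 (1# + h) _ (trans (geometric-sum h N) (trans (cong (1# +_) h^N≡1) char2))
  ... | inj₁ 1+h≡0 = ⊥-elim (h≢1 (sym (x+y≡0⇒x≡y 1+h≡0)))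
  ... | inj₂ S≡0   = S≡0

  sum-1-odd : ∀ t → Σ𝔽.sum (λ (_ : Fin (suc (2 ℕ.* t))) → 1#) ≡ 1#
  sum-1-odd zero    = +-identityʳ 1#
  sum-1-odd (suc t) = begin
    Σ𝔽.sum (λ (_ : Fin (suc (2 ℕ.* suc t))) → 1#)            ≡⟨ cong (λ z → Σ𝔽.sum (λ (_ : Fin (suc z)) → 1#)) (ℕP.*-suc 2 t) ⟩
    1# + (1# + Σ𝔽.sum (λ (_ : Fin (suc (2 ℕ.* t))) → 1#))    ≡⟨ +-assoc 1# 1# _ ⟨
    (1# + 1#) + Σ𝔽.sum (λ (_ : Fin (suc (2 ℕ.* t))) → 1#)    ≡⟨ cong₂ _+_ char2 (sum-1-odd t) ⟩
    0# + 1#                                                  ≡⟨ +-identityˡ 1# ⟩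
    1#                                                       ∎

  g^a≢1 : ∀ {a} → 0 < a → a < q ∸ 1 → g ^ a ≢ 1#
  g^a≢1 {suc a} _ a<q∸1 g^a≡1 = ℕD.>⇒∤ a<q∸1 (g-order (suc a) g^a≡1)

  [g^a]^[q∸1]≡1 : ∀ a → (g ^ a) ^ (q ∸ 1) ≡ 1#
  [g^a]^[q∸1]≡1 a = trans (^-comm g a (q ∸ 1)) (trans (cong (_^ a) g^[q∸1]≡1) (1^a≡1 a))

  -- Expanding the trace, Σ_y Tr(y) y^(p-1) over y ∈ F_q^* is a sum of geometric
  -- series Σ_y y^(2^j + p - 1); all vanish except the one with exponent q - 1.
  trace-moment : Σ𝔽.sum (λ (k : Fin (q ∸ 1)) → trace m (g ^ toℕ k) * (g ^ toℕ k) ^ (p ∸ 1)) ≡ 1#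
  trace-moment = begin
    Σ𝔽.sum (λ k → trace m (y k) * y k ^ P)                                 ≡⟨ Σ𝔽.sum-cong-≗ (λ k → distribʳ (y k ^ P) (trace m′ (y k)) (y k ^ p)) ⟩
    Σ𝔽.sum (λ k → trace m′ (y k) * y k ^ P + y k ^ p * y k ^ P)            ≡⟨ Σ𝔽.∑-distrib-+ (λ k → trace m′ (y k) * y k ^ P) (λ k → y k ^ p * y k ^ P) ⟩
    Σ𝔽.sum (λ k → trace m′ (y k) * y k ^ P) + Σ𝔽.sum (λ k → y k ^ p * y k ^ P) ≡⟨ cong₂ _+_ lower-terms top-term ⟩
    0# + 1#                                                                ≡⟨ +-identityˡ 1# ⟩
    1#                                                                     ∎
    where
    P = p ∸ 1
    y : Fin (q ∸ 1) → Carrier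
    y k = g ^ toℕ k
    y^[a+b] : ∀ k a b → y k ^ a * y k ^ b ≡ (g ^ (a ℕ.+ b)) ^ toℕ k
    y^[a+b] k a b = trans (sym (^-homo-* (y k) a b)) (^-comm g (toℕ k) (a ℕ.+ b))
    lower-terms : Σ𝔽.sum (λ k → trace m′ (y k) * y k ^ P) ≡ 0#
    lower-terms = begin
      Σ𝔽.sum (λ k → trace m′ (y k) * y k ^ P)                        ≡⟨ Σ𝔽.sum-cong-≗ (λ k → trans (cong (_* y k ^ P) (trace-as-sum m′ (y k))) (Σ𝔽.*-distribʳ-sum (y k ^ P) (λ (j : Fin m′) → y k ^ (2 ℕ.^ toℕ j)))) ⟩
      Σ𝔽.sum (λ k → Σ𝔽.sum (λ (j : Fin m′) → y k ^ (2 ℕ.^ toℕ j) * y k ^ P))     ≡⟨ Σ𝔽.∑-comm (λ (k : Fin (q ∸ 1)) (j : Fin m′) → y k ^ (2 ℕ.^ toℕ j) * y k ^ P) ⟩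
      Σ𝔽.sum (λ (j : Fin m′) → Σ𝔽.sum (λ k → y k ^ (2 ℕ.^ toℕ j) * y k ^ P))     ≡⟨ Σ𝔽.sum-cong-≗ vanishes ⟩
      Σ𝔽.sum (λ (j : Fin m′) → 0#)                                  ≡⟨ Σ𝔽.sum-replicate-zero m′ ⟩
      0#                                                            ∎
      where
      vanishes : ∀ (j : Fin m′) → Σ𝔽.sum (λ k → y k ^ (2 ℕ.^ toℕ j) * y k ^ P) ≡ 0#
      vanishes j = trans (Σ𝔽.sum-cong-≗ (λ k → y^[a+b] k (2 ℕ.^ toℕ j) P))
                         (geometric-sum-period (q ∸ 1) ([g^a]^[q∸1]≡1 a) (g^a≢1 0<a a<q∸1))
        where
        a = 2 ℕ.^ toℕ j ℕ.+ P
        0<a : 0 < a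
        0<a = ℕP.<-≤-trans (ℕP.m^n>0 2 (toℕ j)) (ℕP.m≤m+n _ P)
        a<q∸1 : a < q ∸ 1
        a<q∸1 = subst (a <_) (p+[p∸1]≡2p∸1 p) (ℕP.+-monoˡ-< P (ℕP.^-monoʳ-< 2 (s≤s (s≤s z≤n)) (FinP.toℕ<n j)))
    top-term : Σ𝔽.sum (λ k → y k ^ p * y k ^ P) ≡ 1#
    top-term = begin
      Σ𝔽.sum (λ k → y k ^ p * y k ^ P)                 ≡⟨ Σ𝔽.sum-cong-≗ (λ k → trans (y^[a+b] k p P) (cong (λ z → (g ^ z) ^ toℕ k) (p+[p∸1]≡2p∸1 p))) ⟩
      Σ𝔽.sum (λ (k : Fin (q ∸ 1)) → (g ^ (q ∸ 1)) ^ toℕ k)             ≡⟨ Σ𝔽.sum-cong-≗ {q ∸ 1} (λ k → trans (cong (_^ toℕ k) g^[q∸1]≡1) (1^a≡1 (toℕ k))) ⟩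
      Σ𝔽.sum (λ (_ : Fin (q ∸ 1)) → 1#)                ≡⟨ cong (λ z → Σ𝔽.sum (λ (_ : Fin z) → 1#)) q∸1≡1+2[p∸1] ⟩
      Σ𝔽.sum (λ (_ : Fin (suc (2 ℕ.* P))) → 1#)        ≡⟨ sum-1-odd P ⟩
      1#                                               ∎

  trace-one : ∃ λ k → k < q ∸ 1 × trace m (g ^ k) ≡ 1#
  trace-one with FinP.any? (λ (k : Fin (q ∸ 1)) → trace m (g ^ toℕ k) ≟ 1#)
  ... | yes (k , Tr≡1) = toℕ k , FinP.toℕ<n k , Tr≡1
  ... | no  none       = ⊥-elim (0≢1 (trans (sym moment≡0) trace-moment))
    where
    trace≡0 : ∀ k → trace m (g ^ toℕ k) ≡ 0#
    trace≡0 k with Fq-trace-IsBit (Fq-g^ (toℕ k))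
    ... | inj₁ Tr≡0 = Tr≡0
    ... | inj₂ Tr≡1 = ⊥-elim (none (k , Tr≡1))
    moment≡0 : Σ𝔽.sum (λ (k : Fin (q ∸ 1)) → trace m (g ^ toℕ k) * (g ^ toℕ k) ^ (p ∸ 1)) ≡ 0#
    moment≡0 = trans (Σ𝔽.sum-cong-≗ (λ k → trans (cong (_* (g ^ toℕ k) ^ (p ∸ 1)) (trace≡0 k)) (zeroˡ _)))
                     (Σ𝔽.sum-replicate-zero (q ∸ 1))

  Fq-x^[q∸1]≡1 : ∀ {x} → x ≢ 0# → Fq x → x ^ (q ∸ 1) ≡ 1#
  Fq-x^[q∸1]≡1 {x} x≢0 x∈ = *-cancelˡ x x≢0 (begin
    x * x ^ (q ∸ 1)      ≡⟨ cong (x ^_) (ℕP.suc-pred q {{ℕP.m^n≢0 2 m}}) ⟩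
    x ^ q                ≡⟨ x∈ ⟩
    x                    ≡⟨ *-identityʳ x ⟨
    x * 1#               ∎)

  -- Kept abstract: unfolding the discrete logarithm makes later type checking very slow.
  abstract
    Fq-log : ∀ {y} → y ≢ 0# → Fq y → ∃ λ k → k < q ∸ 1 × g ^ k ≡ y
    Fq-log {y} y≢0 y∈ with discrete-log y≢0
    ... | j , j<D , ω^j≡y with q+1∣j
      where
      q+1∣j : (q ℕ.+ 1) ℕD.∣ j
      q+1∣j = ℕD.*-cancelʳ-∣ (q ∸ 1) (subst (ℕD._∣ j ℕ.* (q ∸ 1)) 2^n∸1≡[q+1]*[q∸1] (ω-order _ (begin
        ω ^ (j ℕ.* (q ∸ 1))      ≡⟨ ^-assocʳ ω j (q ∸ 1) ⟨
        (ω ^ j) ^ (q ∸ 1)        ≡⟨ cong (_^ (q ∸ 1)) ω^j≡y ⟩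
        y ^ (q ∸ 1)              ≡⟨ Fq-x^[q∸1]≡1 y≢0 y∈ ⟩
        1#                       ∎)))
    ... | divides t refl = t , t<q∸1 , trans (trans (^-assocʳ ω (q ℕ.+ 1) t) (cong (ω ^_) (ℕP.*-comm (q ℕ.+ 1) t))) ω^j≡y
      where
      t<q∸1 : t < q ∸ 1
      t<q∸1 = ℕP.*-cancelʳ-< (q ℕ.+ 1) t (q ∸ 1) (subst (t ℕ.* (q ℕ.+ 1) <_) 2^n∸1≡[q∸1]*[q+1] j<D)

  Fq-element : Fin (suc (q ∸ 1)) → Carrier
  Fq-element zero    = 0#
  Fq-element (suc k) = g ^ toℕ k

  Fq-element∈Fq : ∀ i → Fq (Fq-element i)
  Fq-element∈Fq zero    = Fq-0
  Fq-element∈Fq (suc k) = Fq-g^ (toℕ k)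

  Fq-index : Carrier → Fin (suc (q ∸ 1))
  Fq-index y with y ≟ 0# | y ^ q ≟ y
  ... | no y≢0 | yes y∈ = suc (Fin.fromℕ< (proj₁ (proj₂ (Fq-log y≢0 y∈))))
  ... | _      | _      = zero

  Fq-element∘Fq-index : ∀ {y} → Fq y → Fq-element (Fq-index y) ≡ y
  Fq-element∘Fq-index {y} y∈ with y ≟ 0# | y ^ q ≟ y
  ... | yes y≡0 | _      = sym y≡0
  ... | no y≢0  | yes y∈′ =
    trans (cong (g ^_) (FinP.toℕ-fromℕ< (proj₁ (proj₂ (Fq-log y≢0 y∈′))))) (proj₂ (proj₂ (Fq-log y≢0 y∈′)))
  ... | no _    | no y∉  = ⊥-elim (y∉ y∈)

  Fq-index∘Fq-element : ∀ i → Fq-index (Fq-element i) ≡ i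
  Fq-index∘Fq-element zero with 0# ≟ 0#
  ... | yes _   = refl
  ... | no  0≢0 = ⊥-elim (0≢0 refl)
  Fq-index∘Fq-element (suc k) with g ^ toℕ k ≟ 0# | (g ^ toℕ k) ^ q ≟ g ^ toℕ k
  ... | yes g^k≡0 | _      = ⊥-elim (^-≢0 (toℕ k) g≢0 g^k≡0)
  ... | no _      | no g^k∉ = ⊥-elim (g^k∉ (Fq-g^ (toℕ k)))
  ... | no g^k≢0  | yes g^k∈ with Fq-log g^k≢0 g^k∈
  ...   | j , j<q∸1 , g^j≡g^k =
    cong suc (FinP.toℕ-injective (trans (FinP.toℕ-fromℕ< j<q∸1) (g-injective j<q∸1 (FinP.toℕ<n k) g^j≡g^k)))

  Fq-translate : Carrier → Fin (suc (q ∸ 1)) → Fin (suc (q ∸ 1))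
  Fq-translate y₀ i = Fq-index (Fq-element i + y₀)

  Fq-element∘Fq-translate : ∀ {y₀} → Fq y₀ → ∀ i → Fq-element (Fq-translate y₀ i) ≡ Fq-element i + y₀
  Fq-element∘Fq-translate y₀∈ i = Fq-element∘Fq-index (Fq-+ (Fq-element∈Fq i) y₀∈)

  Fq-translation : ∀ {y₀} → Fq y₀ → Permutation (suc (q ∸ 1)) (suc (q ∸ 1))
  Fq-translation {y₀} y₀∈ = mk↔ₛ′ (Fq-translate y₀) (Fq-translate y₀) involutive involutive
    where
    involutive : ∀ i → Fq-translate y₀ (Fq-translate y₀ i) ≡ i
    involutive i = begin
      Fq-index (Fq-element (Fq-translate y₀ i) + y₀)   ≡⟨ cong (λ z → Fq-index (z + y₀)) (Fq-element∘Fq-translate y₀∈ i) ⟩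
      Fq-index ((Fq-element i + y₀) + y₀)              ≡⟨ cong Fq-index (trans (+-assoc _ y₀ y₀) (trans (cong (Fq-element i +_) (x+x≡0 y₀)) (+-identityʳ _))) ⟩
      Fq-index (Fq-element i)                          ≡⟨ Fq-index∘Fq-element i ⟩
      i                                                ∎

  open IntegerSums

  isZero : Carrier → ℤ
  isZero γ = if ⌊ γ ≟ 0# ⌋ then ℤ.+ 1 else ℤ.+ 0

  isZero-* : ∀ γ {y} → y ≢ 0# → isZero (γ * y) ≡ isZero γ
  isZero-* γ {y} y≢0 with γ * y ≟ 0# | γ ≟ 0#
  ... | yes _     | yes _   = refl
  ... | no  _     | no  _   = refl
  ... | yes γy≡0  | no γ≢0  = ⊥-elim (*-≢0 γ≢0 y≢0 γy≡0)
  ... | no  γy≢0  | yes refl = ⊥-elim (γy≢0 (zeroˡ y))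

  private
    sum-1 : ∀ N → sum (λ (_ : Fin N) → ℤ.+ 1) ≡ ℤ.+ N
    sum-1 zero    = refl
    sum-1 (suc N) = cong (ℤ._+_ (ℤ.+ 1)) (sum-1 N)

    S≡-S⇒S≡0 : ∀ {S} → S ≡ ℤ.- S → S ≡ ℤ.+ 0
    S≡-S⇒S≡0 {ℤ.+ zero}    _  = refl
    S≡-S⇒S≡0 {ℤ.+ suc _}   ()
    S≡-S⇒S≡0 {ℤ.-[1+ _ ]}  ()

  -- For γ ≠ 0 the sum over all of F_q vanishes, since translating by an element
  -- y₀ with Tr(γ y₀) = 1 flips every sign.
  character-sum : ∀ {γ} → Fq γ → sum (λ (k : Fin (q ∸ 1)) → sign (trace m (γ * g ^ toℕ k))) ≡ ℤ.+ q ℤ.* isZero γ ℤ.- ℤ.+ 1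
  character-sum {γ} γ∈ with γ ≟ 0#
  ... | yes refl = begin
    sum (λ (k : Fin (q ∸ 1)) → sign (trace m (0# * g ^ toℕ k)))  ≡⟨ sum-cong-≗ {q ∸ 1} (λ k → trans (cong (sign ∘ trace m) (zeroˡ (g ^ toℕ k))) sign-trace-0) ⟩
    sum (λ (_ : Fin (q ∸ 1)) → ℤ.+ 1)                            ≡⟨ sum-1 (q ∸ 1) ⟩
    ℤ.+ (q ∸ 1)                                                  ≡⟨ ℤP.⊖-≥ (ℕP.m^n>0 2 m) ⟨
    q ℤ.⊖ 1                                                      ≡⟨ ℤP.m-n≡m⊖n q 1 ⟨
    ℤ.+ q ℤ.- ℤ.+ 1                                              ≡⟨ cong (ℤ._- ℤ.+ 1) (ℤP.*-identityʳ (ℤ.+ q)) ⟨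
    ℤ.+ q ℤ.* ℤ.+ 1 ℤ.- ℤ.+ 1                                    ∎
    where
    sign-trace-0 : sign (trace m 0#) ≡ ℤ.+ 1
    sign-trace-0 = trans (cong sign (trace-0 m)) sign-0
  ... | no γ≢0 = begin
    R                                    ≡⟨ ℤP.+-identityˡ R ⟨
    ℤ.+ 0 ℤ.+ R                          ≡⟨ cong (ℤ._+ R) (ℤP.+-inverseʳ (ℤ.+ 1)) ⟨
    (ℤ.+ 1 ℤ.- ℤ.+ 1) ℤ.+ R              ≡⟨ ℤP.+-assoc (ℤ.+ 1) (ℤ.- ℤ.+ 1) R ⟩
    ℤ.+ 1 ℤ.+ (ℤ.- ℤ.+ 1 ℤ.+ R)          ≡⟨ cong (ℤ._+_ (ℤ.+ 1)) (ℤP.+-comm (ℤ.- ℤ.+ 1) R) ⟩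
    ℤ.+ 1 ℤ.+ (R ℤ.- ℤ.+ 1)              ≡⟨ ℤP.+-assoc (ℤ.+ 1) R (ℤ.- ℤ.+ 1) ⟨
    (ℤ.+ 1 ℤ.+ R) ℤ.- ℤ.+ 1              ≡⟨ cong (λ z → (z ℤ.+ R) ℤ.- ℤ.+ 1) ψ0≡1 ⟨
    sum ψ ℤ.- ℤ.+ 1                      ≡⟨ cong (ℤ._- ℤ.+ 1) (S≡-S⇒S≡0 S≡-S) ⟩
    ℤ.+ 0 ℤ.- ℤ.+ 1                      ≡⟨ cong (ℤ._- ℤ.+ 1) (ℤP.*-zeroʳ (ℤ.+ q)) ⟨
    ℤ.+ q ℤ.* ℤ.+ 0 ℤ.- ℤ.+ 1            ∎
    where
    R = sum (λ (k : Fin (q ∸ 1)) → sign (trace m (γ * g ^ toℕ k)))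
    y₁ = g ^ proj₁ trace-one
    y₀ = γ ⁻¹ * y₁
    y₀∈ : Fq y₀
    y₀∈ = Fq-* (Fq-⁻¹ γ≢0 γ∈) (Fq-g^ (proj₁ trace-one))
    ψ : Fin (suc (q ∸ 1)) → ℤ
    ψ i = sign (trace m (γ * Fq-element i))
    γy₀≡y₁ : γ * y₀ ≡ y₁
    γy₀≡y₁ = trans (sym (*-assoc γ _ y₁)) (trans (cong (_* y₁) (inverse γ γ≢0)) (*-identityˡ y₁))
    ψ∘translate : ∀ i → ψ (Fq-translate y₀ i) ≡ ℤ.- ψ i
    ψ∘translate i = begin
      sign (trace m (γ * Fq-element (Fq-translate y₀ i)))   ≡⟨ cong (λ z → sign (trace m (γ * z))) (Fq-element∘Fq-translate y₀∈ i) ⟩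
      sign (trace m (γ * (Fq-element i + y₀)))              ≡⟨ cong (sign ∘ trace m) (distribˡ γ _ y₀) ⟩
      sign (trace m (γ * Fq-element i + γ * y₀))            ≡⟨ cong sign (trace-+ m _ (γ * y₀)) ⟩
      sign (trace m (γ * Fq-element i) + trace m (γ * y₀))  ≡⟨ cong (λ z → sign (trace m (γ * Fq-element i) + trace m z)) γy₀≡y₁ ⟩
      sign (trace m (γ * Fq-element i) + trace m y₁)        ≡⟨ cong (λ z → sign (trace m (γ * Fq-element i) + z)) (proj₂ (proj₂ trace-one)) ⟩
      sign (trace m (γ * Fq-element i) + 1#)                ≡⟨ sign-+1 (Fq-trace-IsBit (Fq-* γ∈ (Fq-element∈Fq i))) ⟩
      ℤ.- ψ i                                               ∎
    S≡-S : sum ψ ≡ ℤ.- sum ψ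
    S≡-S = trans (sum-permute ψ (Fq-translation y₀∈)) (trans (sum-cong-≗ ψ∘translate) (sum-neg ψ))
    ψ0≡1 : ψ zero ≡ ℤ.+ 1
    ψ0≡1 = trans (cong (sign ∘ trace m) (zeroʳ γ)) (trans (cong sign (trace-0 m)) sign-0)

  character-sum-shifted : ∀ {γ} → Fq γ → ∀ s →
    sum (λ (k : Fin (q ∸ 1)) → sign (trace m (γ * g ^ (toℕ k ℕ.+ s)))) ≡ ℤ.+ q ℤ.* isZero γ ℤ.- ℤ.+ 1
  character-sum-shifted {γ} γ∈ s = begin
    sum (λ (k : Fin (q ∸ 1)) → sign (trace m (γ * g ^ (toℕ k ℕ.+ s))))   ≡⟨ sum-cong-≗ {q ∸ 1} (λ k → cong (sign ∘ trace m) (regroup (toℕ k))) ⟩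
    sum (λ (k : Fin (q ∸ 1)) → sign (trace m ((γ * g ^ s) * g ^ toℕ k))) ≡⟨ character-sum (Fq-* γ∈ (Fq-g^ s)) ⟩
    ℤ.+ q ℤ.* isZero (γ * g ^ s) ℤ.- ℤ.+ 1                               ≡⟨ cong (λ z → ℤ.+ q ℤ.* z ℤ.- ℤ.+ 1) (isZero-* γ (^-≢0 s g≢0)) ⟩
    ℤ.+ q ℤ.* isZero γ ℤ.- ℤ.+ 1                                          ∎
    where
    regroup : ∀ k → γ * g ^ (k ℕ.+ s) ≡ (γ * g ^ s) * g ^ k
    regroup k = begin
      γ * g ^ (k ℕ.+ s)       ≡⟨ cong (γ *_) (^-homo-* g k s) ⟩
      γ * (g ^ k * g ^ s)     ≡⟨ cong (γ *_) (*-comm _ _) ⟩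
      γ * (g ^ s * g ^ k)     ≡⟨ *-assoc γ _ _ ⟨
      (γ * g ^ s) * g ^ k     ∎

  open DisjointSubsets

  module WalshSpectrum
    (r : Fin (q ℕ.+ 1) → ℕ) (a : Fin (q ℕ.+ 1) → Carrier) (R₀ R₁ : Subset (q ℕ.+ 1))
    (R₀-spec : ∀ i → (i ∈ R₀) ⇔ ((ℤ.+ (q ∸ 1)) ℤD.∣ (ℤ.+ r i)))
    (R₁-spec : ∀ i → (i ∈ R₁) ⇔ (∃ λ (s : ℕ) → (ℤ.+ (q ∸ 1)) ℤD.∣ ((ℤ.+ r i) ℤ.- (ℤ.+ (2 ℕ.^ s)))))
    (t : Fin (q ℕ.+ 1) → ℕ)
    (t-spec : ∀ i → i ∈ R₁ → (ℤ.+ (q ∸ 1)) ℤD.∣ ((ℤ.+ r i) ℤ.- (ℤ.+ (2 ℕ.^ t i))))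
    (card : ∣ R₀ ∣ ℕ.+ ∣ R₁ ∣ ≡ q ℕ.+ 1)
    (root : ℕ → Carrier → Carrier) (root-spec : ∀ s y → root s y ^ (2 ℕ.^ s) ≡ y)
    (f : Carrier → Carrier) (f0≡0 : f 0# ≡ 0#)
    (f-coset : ∀ i x → (∃ λ y → y ≢ 0# × (Fq y × x ≡ u ^ toℕ i * y)) → f x ≡ trace n (a i * x ^ r i))
    (b : Carrier) where

    α β ρ : Fin (q ℕ.+ 1) → Carrier
    α i = a i * u ^ (toℕ i ℕ.* r i) + a i ^ q * (u ^ (toℕ i ℕ.* r i)) ⁻¹
    β i = b * u ^ toℕ i + b ^ q * (u ^ toℕ i) ⁻¹
    ρ i = root (t i) (α i)

    sg T : Fin (q ℕ.+ 1) → ℤ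
    sg i = sign (trace m (α i))
    T i = if ⌊ β i ≟ ρ i ⌋ then ℤ.+ 1 else ℤ.+ 0

    M₀ ΣT : ℤ
    M₀ = sumSub R₀ sg
    ΣT = sumSub R₁ T

    α≡A+A^q : ∀ i → α i ≡ a i * u ^ (toℕ i ℕ.* r i) + (a i * u ^ (toℕ i ℕ.* r i)) ^ q
    α≡A+A^q i = cong (a i * u ^ (toℕ i ℕ.* r i) +_) (sym ([x*u^t]^q (a i) (toℕ i ℕ.* r i)))

    β≡B+B^q : ∀ i → β i ≡ b * u ^ toℕ i + (b * u ^ toℕ i) ^ q
    β≡B+B^q i = cong (b * u ^ toℕ i +_) (sym ([x*u^t]^q b (toℕ i)))

    Fq-α : ∀ i → Fq (α i)
    Fq-α i = subst Fq (sym (α≡A+A^q i)) (Fq-x+x^q _)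

    Fq-β : ∀ i → Fq (β i)
    Fq-β i = subst Fq (sym (β≡B+B^q i)) (Fq-x+x^q _)

    Fq-ρ : ∀ i → Fq (ρ i)
    Fq-ρ i = frobenius-injective (t i) (begin
      (ρ i ^ q) ^ (2 ℕ.^ t i)      ≡⟨ ^-comm (ρ i) q (2 ℕ.^ t i) ⟩
      (ρ i ^ (2 ℕ.^ t i)) ^ q      ≡⟨ cong (_^ q) (root-spec (t i) (α i)) ⟩
      α i ^ q                      ≡⟨ Fq-α i ⟩
      α i                          ≡⟨ root-spec (t i) (α i) ⟨
      ρ i ^ (2 ℕ.^ t i)            ∎)

    summand : Carrier → ℤ
    summand x = sign (f x + trace n (b * x))

    summand-coset : ∀ i {y} → y ≢ 0# → Fq y →
                    summand (u ^ toℕ i * y) ≡ sign (trace m (α i * y ^ r i) + trace m (β i * y))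
    summand-coset i {y} y≢0 y∈ = cong₂ (λ v w → sign (v + w)) f-value b-value
      where
      A = a i * u ^ (toℕ i ℕ.* r i)
      f-value : f (u ^ toℕ i * y) ≡ trace m (α i * y ^ r i)
      f-value = begin
        f (u ^ toℕ i * y)                       ≡⟨ f-coset i _ (y , y≢0 , y∈ , refl) ⟩
        trace n (a i * (u ^ toℕ i * y) ^ r i)   ≡⟨ cong (λ z → trace n (a i * z)) (trans (^-distrib-* _ y (r i)) (cong (_* y ^ r i) (^-assocʳ u (toℕ i) (r i)))) ⟩
        trace n (a i * (u ^ (toℕ i ℕ.* r i) * y ^ r i))   ≡⟨ cong (trace n) (*-assoc (a i) _ _) ⟨
        trace n (A * y ^ r i)                   ≡⟨ trace-n≡trace-m A (Fq-^ (r i) y∈) ⟩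
        trace m ((A + A ^ q) * y ^ r i)         ≡⟨ cong (λ z → trace m (z * y ^ r i)) (α≡A+A^q i) ⟨
        trace m (α i * y ^ r i)                 ∎
      b-value : trace n (b * (u ^ toℕ i * y)) ≡ trace m (β i * y)
      b-value = begin
        trace n (b * (u ^ toℕ i * y))                                 ≡⟨ cong (trace n) (*-assoc b _ y) ⟨
        trace n (b * u ^ toℕ i * y)                                   ≡⟨ trace-n≡trace-m (b * u ^ toℕ i) y∈ ⟩
        trace m ((b * u ^ toℕ i + (b * u ^ toℕ i) ^ q) * y)           ≡⟨ cong (λ z → trace m (z * y)) (β≡B+B^q i) ⟨
        trace m (β i * y)                                             ∎

    point : Fin (q ℕ.+ 1) → Fin (q ∸ 1) → Carrier
    point i k = g ^ (toℕ k ℕ.+ shift (toℕ i))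

    coset-sum : Fin (q ℕ.+ 1) → ℤ
    coset-sum i = sum (λ (k : Fin (q ∸ 1)) → summand (ω ^ ((q ℕ.+ 1) ℕ.* toℕ k ℕ.+ toℕ i)))

    coset-sum-traces : ∀ i → coset-sum i ≡ sum (λ k → sign (trace m (α i * point i k ^ r i) + trace m (β i * point i k)))
    coset-sum-traces i = sum-cong-≗ {q ∸ 1} (λ k → trans (cong summand (ω^-coset (toℕ k) (toℕ i)))
                                                 (summand-coset i (^-≢0 (toℕ k ℕ.+ shift (toℕ i)) g≢0) (Fq-g^ (toℕ k ℕ.+ shift (toℕ i)))))

    coset-sum-R₀ : ∀ i → i ∈ R₀ → coset-sum i ≡ ℤ.+ q ℤ.* (sg i ℤ.* isZero (β i)) ℤ.- sg i
    coset-sum-R₀ i i∈R₀ = begin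
      coset-sum i                                                                ≡⟨ coset-sum-traces i ⟩
      sum (λ k → sign (trace m (α i * point i k ^ r i) + trace m (β i * point i k)))  ≡⟨ sum-cong-≗ term ⟩
      sum (λ k → sg i ℤ.* sign (trace m (β i * point i k)))                      ≡⟨ *-distribˡ-sum (sg i) (λ k → sign (trace m (β i * point i k))) ⟨
      sg i ℤ.* sum (λ k → sign (trace m (β i * point i k)))                      ≡⟨ cong (sg i ℤ.*_) (character-sum-shifted (Fq-β i) (shift (toℕ i))) ⟩
      sg i ℤ.* (ℤ.+ q ℤ.* isZero (β i) ℤ.- ℤ.+ 1)                                ≡⟨ distribute (ℤ.+ q) (sg i) (isZero (β i)) ⟩
      ℤ.+ q ℤ.* (sg i ℤ.* isZero (β i)) ℤ.- sg i                                 ∎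
      where
      distribute : ∀ Q s z → s ℤ.* (Q ℤ.* z ℤ.- ℤ.+ 1) ≡ Q ℤ.* (s ℤ.* z) ℤ.- s
      distribute = ℤ-solve-∀
      term : ∀ k → sign (trace m (α i * point i k ^ r i) + trace m (β i * point i k))
                 ≡ sg i ℤ.* sign (trace m (β i * point i k))
      term k = begin
        sign (trace m (α i * point i k ^ r i) + trace m (β i * point i k))  ≡⟨ cong (λ z → sign (trace m (α i * z) + trace m (β i * point i k))) y^r≡1 ⟩
        sign (trace m (α i * 1#) + trace m (β i * point i k))              ≡⟨ cong (λ z → sign (trace m z + trace m (β i * point i k))) (*-identityʳ (α i)) ⟩
        sign (trace m (α i) + trace m (β i * point i k))                   ≡⟨ sign-+ (Fq-trace-IsBit (Fq-α i)) (Fq-trace-IsBit (Fq-* (Fq-β i) (Fq-g^ (toℕ k ℕ.+ shift (toℕ i))))) ⟩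
        sg i ℤ.* sign (trace m (β i * point i k))                          ∎
        where
        y^r≡1 : point i k ^ r i ≡ 1#
        y^r≡1 = ^-≡1 (q ∸ 1) ([g^a]^[q∸1]≡1 (toℕ k ℕ.+ shift (toℕ i))) (Equivalence.to (R₀-spec i) i∈R₀)

    isZero-ρ+β : ∀ i → isZero (ρ i + β i) ≡ T i
    isZero-ρ+β i with ρ i + β i ≟ 0# | β i ≟ ρ i
    ... | yes _      | yes _    = refl
    ... | no  _      | no  _    = refl
    ... | yes ρ+β≡0  | no β≢ρ   = ⊥-elim (β≢ρ (sym (x+y≡0⇒x≡y ρ+β≡0)))
    ... | no  ρ+β≢0  | yes β≡ρ  = ⊥-elim (ρ+β≢0 (x≡y⇒x+y≡0 (sym β≡ρ)))

    -- On a coset with r ≡ 2^t (mod q - 1), Tr(α y^r) = Tr(ρ y) for ρ = α^(2^-t).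
    coset-sum-R₁ : ∀ i → i ∈ R₁ → coset-sum i ≡ ℤ.+ q ℤ.* T i ℤ.- ℤ.+ 1
    coset-sum-R₁ i i∈R₁ = begin
      coset-sum i                                                                ≡⟨ coset-sum-traces i ⟩
      sum (λ k → sign (trace m (α i * point i k ^ r i) + trace m (β i * point i k)))  ≡⟨ sum-cong-≗ (cong sign ∘ term) ⟩
      sum (λ k → sign (trace m ((ρ i + β i) * point i k)))                      ≡⟨ character-sum-shifted (Fq-+ (Fq-ρ i) (Fq-β i)) (shift (toℕ i)) ⟩
      ℤ.+ q ℤ.* isZero (ρ i + β i) ℤ.- ℤ.+ 1                                     ≡⟨ cong (λ z → ℤ.+ q ℤ.* z ℤ.- ℤ.+ 1) (isZero-ρ+β i) ⟩
      ℤ.+ q ℤ.* T i ℤ.- ℤ.+ 1                                                    ∎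
      where
      term : ∀ k → trace m (α i * point i k ^ r i) + trace m (β i * point i k) ≡ trace m ((ρ i + β i) * point i k)
      term k = begin
        trace m (α i * y ^ r i) + trace m (β i * y)              ≡⟨ cong (λ z → trace m (α i * z) + trace m (β i * y)) y^r≡y^2^t ⟩
        trace m (α i * y ^ 2^t) + trace m (β i * y)              ≡⟨ cong (λ z → trace m (z * y ^ 2^t) + trace m (β i * y)) (root-spec (t i) (α i)) ⟨
        trace m (ρ i ^ 2^t * y ^ 2^t) + trace m (β i * y)        ≡⟨ cong (λ z → trace m z + trace m (β i * y)) (^-distrib-* (ρ i) y 2^t) ⟨
        trace m ((ρ i * y) ^ 2^t) + trace m (β i * y)            ≡⟨ cong (_+ trace m (β i * y)) (Fq-trace-^2^t (t i) (Fq-* (Fq-ρ i) (Fq-g^ (toℕ k ℕ.+ shift (toℕ i))))) ⟩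
        trace m (ρ i * y) + trace m (β i * y)                    ≡⟨ trace-+ m (ρ i * y) (β i * y) ⟨
        trace m (ρ i * y + β i * y)                              ≡⟨ cong (trace m) (distribʳ y (ρ i) (β i)) ⟨
        trace m ((ρ i + β i) * y)                                ∎
        where
        y = point i k
        2^t = 2 ℕ.^ t i
        y^r≡y^2^t : y ^ r i ≡ y ^ 2^t
        y^r≡y^2^t = ^-≡-mod (q ∸ 1) ([g^a]^[q∸1]≡1 (toℕ k ℕ.+ shift (toℕ i))) (r i) 2^t (t-spec i i∈R₁)

    R₀∩R₁⇒q∸1≡1 : ∀ {i} → i ∈ R₀ → i ∈ R₁ → q ∸ 1 ≡ 1
    R₀∩R₁⇒q∸1≡1 {i} i∈R₀ i∈R₁ with Equivalence.to (R₁-spec i) i∈R₁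
    ... | s , q∸1∣r-2^s = ℕD.∣1⇒≡1 (g-order 1 (trans (x^1≡x g) g≡1))
      where
      g≡1 : g ≡ 1#
      g≡1 = frobenius-injective s (begin
        g ^ (2 ℕ.^ s)     ≡⟨ ^-≡-mod (q ∸ 1) g^[q∸1]≡1 (r i) (2 ℕ.^ s) q∸1∣r-2^s ⟨
        g ^ r i           ≡⟨ ^-≡1 (q ∸ 1) g^[q∸1]≡1 (Equivalence.to (R₀-spec i) i∈R₀) ⟩
        1#                ≡⟨ 1^a≡1 (2 ℕ.^ s) ⟨
        1# ^ (2 ℕ.^ s)    ∎)

    -- If q - 1 = 1 every index would lie in both R₀ and R₁, contradicting #R₀ + #R₁ = q + 1.
    R₀-R₁-disjoint : Disjoint R₀ R₁
    R₀-R₁-disjoint i∈R₀ i∈R₁ = ℕP.<-irrefl refl (ℕP.<-≤-trans (ℕP.m<m+n (q ℕ.+ 1) (ℕ.>-nonZero⁻¹ (q ℕ.+ 1)))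
      (subst ((q ℕ.+ 1) ℕ.+ (q ℕ.+ 1) ≤_) card (ℕP.+-mono-≤ (full all∈R₀) (full all∈R₁))))
      where
      q∸1≡1 = R₀∩R₁⇒q∸1≡1 i∈R₀ i∈R₁
      1∣ : ∀ x → (q ∸ 1) ℕD.∣ x
      1∣ x = subst (ℕD._∣ x) (sym q∸1≡1) (ℕD.1∣ x)
      all∈R₀ : ∀ j → j ∈ R₀
      all∈R₀ j = Equivalence.from (R₀-spec j) (1∣ (r j))
      all∈R₁ : ∀ j → j ∈ R₁
      all∈R₁ j = Equivalence.from (R₁-spec j) (0 , 1∣ _)
      full : ∀ {R : Subset (q ℕ.+ 1)} → (∀ j → j ∈ R) → q ℕ.+ 1 ≤ ∣ R ∣
      full {R} all∈R = subst (_≤ ∣ R ∣) (∣⊤∣≡n (q ℕ.+ 1)) (p⊆q⇒∣p∣≤∣q∣ {p = ⊤} (λ {j} _ → all∈R j))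

    R₀-or-R₁ : ∀ i → i ∈ R₀ ⊎ i ∈ R₁
    R₀-or-R₁ = covering R₀ R₁ R₀-R₁-disjoint card

    summand-0 : summand 0# ≡ ℤ.+ 1
    summand-0 = begin
      sign (f 0# + trace n (b * 0#))    ≡⟨ cong₂ (λ v w → sign (v + trace n w)) f0≡0 (zeroʳ b) ⟩
      sign (0# + trace n 0#)            ≡⟨ cong (λ z → sign (0# + z)) (trace-0 n) ⟩
      sign (0# + 0#)                    ≡⟨ cong sign (+-identityˡ 0#) ⟩
      sign 0#                           ≡⟨ sign-0 ⟩
      ℤ.+ 1                             ∎

    walsh≡1+Σcoset-sum : walsh f b ≡ ℤ.+ 1 ℤ.+ sum coset-sum
    walsh≡1+Σcoset-sum = begin
      walsh f b                                                          ≡⟨ sumF-powers summand ⟩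
      summand 0# ℤ.+ sum (λ (j : Fin D) → summand (ω ^ toℕ j))           ≡⟨ cong₂ ℤ._+_ summand-0 (cong (λ N → sum (λ (j : Fin N) → summand (ω ^ toℕ j))) 2^n∸1≡[q∸1]*[q+1]) ⟩
      ℤ.+ 1 ℤ.+ sum (λ (j : Fin ((q ∸ 1) ℕ.* (q ℕ.+ 1))) → summand (ω ^ toℕ j))
        ≡⟨ cong (ℤ._+_ (ℤ.+ 1)) (sum-combine (q ∸ 1) (q ℕ.+ 1) (λ j → summand (ω ^ toℕ j))) ⟩
      ℤ.+ 1 ℤ.+ sum (λ (k : Fin (q ∸ 1)) → sum (λ (l : Fin (q ℕ.+ 1)) → summand (ω ^ toℕ (combine k l))))
        ≡⟨ cong (ℤ._+_ (ℤ.+ 1)) (sum-cong-≗ {q ∸ 1} (λ k → sum-cong-≗ {q ℕ.+ 1} (λ l → cong (λ z → summand (ω ^ z)) (FinP.toℕ-combine k l)))) ⟩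
      ℤ.+ 1 ℤ.+ sum (λ (k : Fin (q ∸ 1)) → sum (λ (l : Fin (q ℕ.+ 1)) → summand (ω ^ ((q ℕ.+ 1) ℕ.* toℕ k ℕ.+ toℕ l))))
        ≡⟨ cong (ℤ._+_ (ℤ.+ 1)) (∑-comm (λ (k : Fin (q ∸ 1)) (l : Fin (q ℕ.+ 1)) → summand (ω ^ ((q ℕ.+ 1) ℕ.* toℕ k ℕ.+ toℕ l)))) ⟩
      ℤ.+ 1 ℤ.+ sum coset-sum                                            ∎

    ΣA : ℤ
    ΣA = sum (indicator R₀ (λ i → sg i ℤ.* isZero (β i)))

    Σcoset-sum : sum coset-sum ≡ (ℤ.+ q ℤ.* ΣA ℤ.- M₀) ℤ.+ (ℤ.+ q ℤ.* ΣT ℤ.- ℤ.+ ∣ R₁ ∣)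
    Σcoset-sum = begin
      sum coset-sum                                      ≡⟨ sum-cong-≗ (λ i → indicator-partition R₀-R₁-disjoint R₀-or-R₁ {X} {Y} i (coset-sum-R₀ i) (coset-sum-R₁ i)) ⟩
      sum (λ i → indicator R₀ X i ℤ.+ indicator R₁ Y i)  ≡⟨ ∑-distrib-+ (indicator R₀ X) (indicator R₁ Y) ⟩
      sum (indicator R₀ X) ℤ.+ sum (indicator R₁ Y)      ≡⟨ cong₂ ℤ._+_ (indicator-affine R₀ (ℤ.+ q) (λ i → sg i ℤ.* isZero (β i)) sg)
                                                                        (indicator-affine R₁ (ℤ.+ q) T (λ _ → ℤ.+ 1)) ⟩
      (ℤ.+ q ℤ.* ΣA ℤ.- sum (indicator R₀ sg)) ℤ.+ (ℤ.+ q ℤ.* sum (indicator R₁ T) ℤ.- sum (indicator R₁ (λ _ → ℤ.+ 1)))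
        ≡⟨ cong₃ (λ x y z → (ℤ.+ q ℤ.* ΣA ℤ.- x) ℤ.+ (ℤ.+ q ℤ.* y ℤ.- z)) (sumSub≡sum R₀ sg) (sumSub≡sum R₁ T) (∣R∣≡sum-indicator R₁) ⟨
      (ℤ.+ q ℤ.* ΣA ℤ.- M₀) ℤ.+ (ℤ.+ q ℤ.* ΣT ℤ.- ℤ.+ ∣ R₁ ∣)                                                              ∎
      where
      X Y : Fin (q ℕ.+ 1) → ℤ
      X i = ℤ.+ q ℤ.* (sg i ℤ.* isZero (β i)) ℤ.- sg i
      Y i = ℤ.+ q ℤ.* T i ℤ.- ℤ.+ 1
      cong₃ : ∀ (h : ℤ → ℤ → ℤ → ℤ) {x x′ y y′ z z′} → x ≡ x′ → y ≡ y′ → z ≡ z′ → h x y z ≡ h x′ y′ z′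
      cong₃ h refl refl refl = refl

    walsh-formula : walsh f b ≡ ℤ.+ 1 ℤ.+ ((ℤ.+ q ℤ.* ΣA ℤ.- M₀) ℤ.+ (ℤ.+ q ℤ.* ΣT ℤ.- ℤ.+ ∣ R₁ ∣))
    walsh-formula = trans walsh≡1+Σcoset-sum (cong (ℤ._+_ (ℤ.+ 1)) Σcoset-sum)

    isZero-0 : isZero 0# ≡ ℤ.+ 1
    isZero-0 with 0# ≟ 0#
    ... | yes _   = refl
    ... | no  0≢0 = ⊥-elim (0≢0 refl)

    ΣA-b≡0 : b ≡ 0# → ΣA ≡ M₀
    ΣA-b≡0 b≡0 = begin
      sum (indicator R₀ (λ i → sg i ℤ.* isZero (β i)))   ≡⟨ sum-cong-≗ (indicator-cong R₀ (λ i _ → trans (cong (λ z → sg i ℤ.* isZero z) (β≡0 i)) (trans (cong (sg i ℤ.*_) isZero-0) (ℤP.*-identityʳ (sg i))))) ⟩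
      sum (indicator R₀ sg)                              ≡⟨ sumSub≡sum R₀ sg ⟨
      M₀                                                 ∎
      where
      β≡0 : ∀ i → β i ≡ 0#
      β≡0 i = begin
        b * u ^ toℕ i + b ^ q * (u ^ toℕ i) ⁻¹      ≡⟨ cong (λ z → z * u ^ toℕ i + z ^ q * (u ^ toℕ i) ⁻¹) b≡0 ⟩
        0# * u ^ toℕ i + 0# ^ q * (u ^ toℕ i) ⁻¹    ≡⟨ cong₂ _+_ (zeroˡ _) (trans (cong (_* (u ^ toℕ i) ⁻¹) Fq-0) (zeroˡ _)) ⟩
        0# + 0#                                     ≡⟨ +-identityˡ 0# ⟩
        0#                                          ∎

    -- For b ≠ 0 with b^(q-1) = u^(2s), β i vanishes exactly for i = s.
    module _ (s : Fin (q ℕ.+ 1)) (b^[q∸1]≡u^2s : b ^ (q ∸ 1) ≡ u ^ (2 ℕ.* toℕ s)) where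

      private
        v = u ^ toℕ s

        b^[q∸1]≡v*v : b ^ (q ∸ 1) ≡ v * v
        b^[q∸1]≡v*v = begin
          b ^ (q ∸ 1)             ≡⟨ b^[q∸1]≡u^2s ⟩
          u ^ (2 ℕ.* toℕ s)       ≡⟨ cong (u ^_) (ℕP.*-comm 2 (toℕ s)) ⟩
          u ^ (toℕ s ℕ.* 2)       ≡⟨ ^-assocʳ u (toℕ s) 2 ⟨
          v ^ 2                   ≡⟨ x^2≡x*x v ⟩
          v * v                   ∎

        b≢0 : b ≢ 0#
        b≢0 b≡0 = ^-≢0 (2 ℕ.* toℕ s) u≢0 (trans (sym b^[q∸1]≡u^2s) (trans (cong (_^ (q ∸ 1)) b≡0) 0^[q∸1]≡0))
          where
          0^[q∸1]≡0 : 0# ^ (q ∸ 1) ≡ 0#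
          0^[q∸1]≡0 = subst (λ z → 0# ^ z ≡ 0#) (sym q∸1≡1+2[p∸1]) (0^[1+a]≡0 (2 ℕ.* (p ∸ 1)))

        b^q≡b*v*v : b ^ q ≡ b * (v * v)
        b^q≡b*v*v = trans (cong (b ^_) (sym (ℕP.suc-pred q {{ℕP.m^n≢0 2 m}}))) (cong (b *_) b^[q∸1]≡v*v)

        u^i≢0 : ∀ (i : Fin (q ℕ.+ 1)) → u ^ toℕ i ≢ 0#
        u^i≢0 i = ^-≢0 (toℕ i) u≢0

        β≡0⇒≡s : ∀ i → β i ≡ 0# → i ≡ s
        β≡0⇒≡s i βi≡0 = FinP.toℕ-injective (u-injective (FinP.toℕ<n i) (FinP.toℕ<n s) (square-injective (begin
          w ^ 2                           ≡⟨ x^2≡x*x w ⟩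
          w * w                           ≡⟨ *-cancelˡ b b≢0 b[w*w]≡b[v*v] ⟩
          v * v                           ≡⟨ x^2≡x*x v ⟨
          v ^ 2                           ∎)))
          where
          w = u ^ toℕ i
          b[w*w]≡b[v*v] : b * (w * w) ≡ b * (v * v)
          b[w*w]≡b[v*v] = begin
            b * (w * w)                   ≡⟨ *-assoc b w w ⟨
            (b * w) * w                   ≡⟨ cong (_* w) (x+y≡0⇒x≡y βi≡0) ⟩
            (b ^ q * w ⁻¹) * w            ≡⟨ *-assoc _ (w ⁻¹) w ⟩
            b ^ q * (w ⁻¹ * w)            ≡⟨ cong (b ^ q *_) (⁻¹-inverseˡ w (u^i≢0 i)) ⟩
            b ^ q * 1#                    ≡⟨ *-identityʳ _ ⟩
            b ^ q                         ≡⟨ b^q≡b*v*v ⟩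
            b * (v * v)                   ∎

        βs≡0 : β s ≡ 0#
        βs≡0 = x≡y⇒x+y≡0 (begin
          b * v                           ≡⟨ *-identityʳ _ ⟨
          (b * v) * 1#                    ≡⟨ cong ((b * v) *_) (inverse v (u^i≢0 s)) ⟨
          (b * v) * (v * v ⁻¹)            ≡⟨ *-assoc _ _ _ ⟨
          ((b * v) * v) * v ⁻¹            ≡⟨ cong (_* v ⁻¹) (*-assoc b v v) ⟩
          (b * (v * v)) * v ⁻¹            ≡⟨ cong (_* v ⁻¹) b^q≡b*v*v ⟨
          b ^ q * v ⁻¹                    ∎)

        isZero-β : ∀ i → isZero (β i) ≡ δ s i
        isZero-β i with β i ≟ 0# | i FinP.≟ s
        ... | yes _     | yes _    = refl
        ... | no  _     | no  _    = refl
        ... | yes βi≡0  | no  i≢s  = ⊥-elim (i≢s (β≡0⇒≡s i βi≡0))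
        ... | no  βi≢0  | yes refl = ⊥-elim (βi≢0 βs≡0)

      ΣA-b≢0 : ΣA ≡ indicator R₀ sg s
      ΣA-b≢0 = trans (sum-cong-≗ (indicator-cong R₀ (λ i _ → cong (sg i ℤ.*_) (isZero-β i)))) (sum-indicator-δ R₀ sg s)

    C : ℤ
    C = M₀ ℤ.+ ℤ.+ ∣ R₁ ∣ ℤ.- ℤ.+ 1

    walsh-at-0 : b ≡ 0# → walsh f b ≡ ℤ.+ q ℤ.* (M₀ ℤ.+ ΣT) ℤ.- C
    walsh-at-0 b≡0 = begin
      walsh f b                                                          ≡⟨ walsh-formula ⟩
      ℤ.+ 1 ℤ.+ ((ℤ.+ q ℤ.* ΣA ℤ.- M₀) ℤ.+ (ℤ.+ q ℤ.* ΣT ℤ.- ℤ.+ ∣ R₁ ∣)) ≡⟨ cong (λ z → ℤ.+ 1 ℤ.+ ((ℤ.+ q ℤ.* z ℤ.- M₀) ℤ.+ (ℤ.+ q ℤ.* ΣT ℤ.- ℤ.+ ∣ R₁ ∣))) (ΣA-b≡0 b≡0) ⟩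
      ℤ.+ 1 ℤ.+ ((ℤ.+ q ℤ.* M₀ ℤ.- M₀) ℤ.+ (ℤ.+ q ℤ.* ΣT ℤ.- ℤ.+ ∣ R₁ ∣)) ≡⟨ regroup (ℤ.+ q) M₀ ΣT (ℤ.+ ∣ R₁ ∣) ⟩
      ℤ.+ q ℤ.* (M₀ ℤ.+ ΣT) ℤ.- C                                        ∎
      where
      regroup : ∀ Q M T R → ℤ.+ 1 ℤ.+ ((Q ℤ.* M ℤ.- M) ℤ.+ (Q ℤ.* T ℤ.- R)) ≡ Q ℤ.* (M ℤ.+ T) ℤ.- (M ℤ.+ R ℤ.- ℤ.+ 1)
      regroup = ℤ-solve-∀

    walsh-on-coset : ∀ s → b ^ (q ∸ 1) ≡ u ^ (2 ℕ.* toℕ s) →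
                     walsh f b ≡ ℤ.+ q ℤ.* (indicator R₀ sg s ℤ.+ ΣT) ℤ.- C
    walsh-on-coset s b^[q∸1]≡u^2s = begin
      walsh f b                                                          ≡⟨ walsh-formula ⟩
      ℤ.+ 1 ℤ.+ ((ℤ.+ q ℤ.* ΣA ℤ.- M₀) ℤ.+ (ℤ.+ q ℤ.* ΣT ℤ.- ℤ.+ ∣ R₁ ∣)) ≡⟨ cong (λ z → ℤ.+ 1 ℤ.+ ((ℤ.+ q ℤ.* z ℤ.- M₀) ℤ.+ (ℤ.+ q ℤ.* ΣT ℤ.- ℤ.+ ∣ R₁ ∣))) (ΣA-b≢0 s b^[q∸1]≡u^2s) ⟩
      ℤ.+ 1 ℤ.+ ((ℤ.+ q ℤ.* S ℤ.- M₀) ℤ.+ (ℤ.+ q ℤ.* ΣT ℤ.- ℤ.+ ∣ R₁ ∣))  ≡⟨ regroup (ℤ.+ q) S M₀ ΣT (ℤ.+ ∣ R₁ ∣) ⟩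
      ℤ.+ q ℤ.* (S ℤ.+ ΣT) ℤ.- C                                         ∎
      where
      S = indicator R₀ sg s
      regroup : ∀ Q S M T R → ℤ.+ 1 ℤ.+ ((Q ℤ.* S ℤ.- M) ℤ.+ (Q ℤ.* T ℤ.- R)) ≡ Q ℤ.* (S ℤ.+ T) ℤ.- (M ℤ.+ R ℤ.- ℤ.+ 1)
      regroup = ℤ-solve-∀

    walsh-on-R₀ : ∀ s → s ∈ R₀ → b ^ (q ∸ 1) ≡ u ^ (2 ℕ.* toℕ s) → walsh f b ≡ ℤ.+ q ℤ.* (sg s ℤ.+ ΣT) ℤ.- C
    walsh-on-R₀ s s∈R₀ b^[q∸1]≡u^2s =
      trans (walsh-on-coset s b^[q∸1]≡u^2s) (cong (λ z → ℤ.+ q ℤ.* (z ℤ.+ ΣT) ℤ.- C) (indicator-∈ {X = sg} s∈R₀))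

    walsh-on-R₁ : ∀ s → s ∈ R₁ → b ^ (q ∸ 1) ≡ u ^ (2 ℕ.* toℕ s) → walsh f b ≡ ℤ.+ q ℤ.* ΣT ℤ.- C
    walsh-on-R₁ s s∈R₁ b^[q∸1]≡u^2s =
      trans (walsh-on-coset s b^[q∸1]≡u^2s)
            (cong (λ z → ℤ.+ q ℤ.* z ℤ.- C) (trans (cong (ℤ._+ ΣT) (indicator-∉ {X = sg} (λ s∈R₀ → R₀-R₁-disjoint s∈R₀ s∈R₁))) (ℤP.+-identityˡ ΣT)))

open import Data.Integer using (+_)
open import Data.Integer.Divisibility using (_∣_)

theorem3p1 : (m : ℕ) → 1 ≤ m → (F : GF2 (2 ℕ.* m)) →
  let open GF2 F
      n = 2 ℕ.* m
      q = 2 ℕ.^ m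
  in (ω : Carrier) → IsPrimitive ω →
  let u = ω ^ ((q ∸ 1) ℕ.* (2 ℕ.^ (n ∸ 1) ∸ 1))
      -- x ∈ u^i F_q^*
      inCoset : Fin (q ℕ.+ 1) → Carrier → Set
      inCoset i x = ∃ λ y → (y ≢ 0#) × ((y ^ q ≡ y) × (x ≡ (u ^ toℕ i) * y))
  in (r : Fin (q ℕ.+ 1) → ℕ) → (a : Fin (q ℕ.+ 1) → Carrier) →
  (R₀ R₁ : Subset (q ℕ.+ 1)) →
  (∀ i → (i ∈ R₀) ⇔ ((+ (q ∸ 1)) ∣ (+ r i))) →
  (∀ i → (i ∈ R₁) ⇔ (∃ λ (s : ℕ) → (+ (q ∸ 1)) ∣ ((+ r i) ℤ.- (+ (2 ℕ.^ s))))) →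
  (t : Fin (q ℕ.+ 1) → ℕ) →
  (∀ i → i ∈ R₁ → (+ (q ∸ 1)) ∣ ((+ r i) ℤ.- (+ (2 ℕ.^ t i)))) →
  ∣ R₀ ∣ ℕ.+ ∣ R₁ ∣ ≡ q ℕ.+ 1 →
  -- root s y is the 2^s-th root of y
  (root : ℕ → Carrier → Carrier) → (∀ s y → root s y ^ (2 ℕ.^ s) ≡ y) →
  (f : Carrier → Carrier) → f 0# ≡ 0# →
  (∀ i x → inCoset i x → f x ≡ trace n (a i * (x ^ r i))) →
  let α : Fin (q ℕ.+ 1) → Carrier
      α i = (a i * (u ^ (toℕ i ℕ.* r i))) + ((a i ^ q) * ((u ^ (toℕ i ℕ.* r i)) ⁻¹))
      M₀ = sumSub R₀ (λ i → sign (trace m (α i)))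
      T : Fin (q ℕ.+ 1) → Carrier → ℤ
      T i b = if ⌊ (b * (u ^ toℕ i)) + ((b ^ q) * ((u ^ toℕ i) ⁻¹)) ≟ root (t i) (α i) ⌋
              then + 1 else + 0
      ΣT : Carrier → ℤ
      ΣT b = sumSub R₁ (λ i → T i b)
      C = M₀ ℤ.+ (+ ∣ R₁ ∣) ℤ.- (+ 1)
  in (b : Carrier) →
    ((b ≡ 0# → walsh f b ≡ (+ q) ℤ.* (M₀ ℤ.+ ΣT b) ℤ.- C)
    × (∀ s → s ∈ R₀ → b ^ (q ∸ 1) ≡ u ^ (2 ℕ.* toℕ s) →
         walsh f b ≡ (+ q) ℤ.* (sign (trace m (α s)) ℤ.+ ΣT b) ℤ.- C)
    × (∀ s → s ∈ R₁ → b ^ (q ∸ 1) ≡ u ^ (2 ℕ.* toℕ s) →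
         walsh f b ≡ (+ q) ℤ.* ΣT b ℤ.- C))
theorem3p1 zero ()
theorem3p1 (suc m′) _ F ω prim r a R₀ R₁ R₀-spec R₁-spec t t-spec card root root-spec f f0≡0 f-coset b =
  walsh-at-0 , walsh-on-R₀ , walsh-on-R₁
  where
  open QuadraticExtension.WalshSpectrum m′ F ω prim r a R₀ R₁ R₀-spec R₁-spec t t-spec card root root-spec f f0≡0 f-coset b
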